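{- Let $k>4$ and $n\ge1$ be integers and let $G$ be the carbon nanocone $CNC_k(n)$. Then $$SO(G)=2\sqrt{13}\,kn+\frac{\sqrt{2}k}{2}(9n^2+3n+4),$$ $$SO_{red}(G)=2\sqrt{5}\,kn+\sqrt{2}k(3n^2+n+1),$$ $$SO_{avr}(G)=\frac{kn}{2}\left(\frac{4}{n+1}\sqrt{n^2+1}+3\sqrt{2}\right).$$
   Context: For a graph $G$ with vertex degrees $d_i$: $SO(G)=\sum_{ij\in E(G)}\sqrt{d_i^2+d_j^2}$, $SO_{red}(G)=\sum_{ij\in E(G)}\sqrt{(d_i-1)^2+(d_j-1)^2}$, $SO_{avr}(G)=\sum_{ij\in E(G)}\sqrt{(d_i-\bar d)^2+(d_j-\bar d)^2}$, where $\bar d=2|E(G)|/|V(G)|$. The carbon nanocone $CNC_k(n)$ is the (planar) graph whose core is a $k$-cycle (a $k$-gonal face) surrounded by $n$ concentric layers of hexagons, as in the standard carbon nanocone construction: each new layer is the ring of hexagons attached around the outer boundary of the previous structure, so that all vertices have degree $2$ or $3$. It has $k(n+1)^2$ vertices and $k(n+1)(3n+2)/2$ edges. -}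

module Defs where

open import Level using (Level; _⊔_) renaming (suc to lsuc)
open import Data.Nat as ℕ using (ℕ; zero; suc; _∸_; _≡ᵇ_)
open import Data.Bool using (if_then_else_)
open import Data.Product using (_×_; _,_)
open import Data.Nat.ListAction using (sum)
open import Data.List as List using (List; []; _∷_; _++_; map; concatMap; upTo; length; foldr)
open import Algebra.Bundles using (CommutativeRing)
open import Relation.Binary.Structures using (IsTotalOrder)
open import Relation.Nullary using (¬_)

-- We work in an
-- arbitrary *Euclidean field*: an ordered field in which every
-- nonnegative element has a (nonnegative) square root.  ℝ is one;
-- the theorem is stated for every such field (in particular for ℝ).

record EuclideanField (c ℓ : Level) : Set (lsuc (c ⊔ ℓ)) where
  field
    commutativeRing : CommutativeRing c ℓ
  open CommutativeRing commutativeRing public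
  infix 4 _≤_
  field
    _≤_         : Carrier → Carrier → Set ℓ
    isTotalOrder : IsTotalOrder _≈_ _≤_
    +-mono-≤    : ∀ {x y} z → x ≤ y → x + z ≤ y + z
    *-nonneg    : ∀ {x y} → 0# ≤ x → 0# ≤ y → 0# ≤ x * y
    0≉1         : ¬ (0# ≈ 1#)
    _⁻¹         : Carrier → Carrier
    inverseʳ    : ∀ x → ¬ (x ≈ 0#) → x * (x ⁻¹) ≈ 1#
    √_          : Carrier → Carrier
    √-nonneg    : ∀ x → 0# ≤ x → 0# ≤ √ x
    √-square    : ∀ x → 0# ≤ x → (√ x) * (√ x) ≈ x

  infixl 6 _−_
  infixl 7 _÷_
  _−_ : Carrier → Carrier → Carrier
  x − y = x + (- y)

  ⟦_⟧ : ℕ → Carrier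
  ⟦ zero ⟧  = 0#
  ⟦ suc n ⟧ = 1# + ⟦ n ⟧

  _÷_ : Carrier → Carrier → Carrier
  x ÷ y = x * (y ⁻¹)

-- Finite simple graphs given by a vertex count and an edge list
-- (vertices are 0 … nV-1; each edge listed once).

record Graph : Set where
  constructor mkGraph
  field
    nV    : ℕ
    edges : List (ℕ × ℕ)
open Graph public

nE : Graph → ℕ
nE G = length (edges G)

degree : Graph → ℕ → ℕ
degree G v = sum (map (λ { (a , b) → (if a ≡ᵇ v then 1 else 0) ℕ.+ (if b ≡ᵇ v then 1 else 0) }) (edges G))

-- Vertices lie on n+1 concentric cycles C_0 … C_n; C_i has k(2i+1)
-- vertices (k sectors of 2i+1 consecutive vertices), numbered
-- k i² + s(2i+1) + p  (sector s < k, position p < 2i+1).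
-- C_0 is the core k-gon.  Layer i (1 ≤ i ≤ n) of hexagons is formed by
-- C_i together with the spokes joining, in each sector s and for each
-- j < i, position 2j of C_{i-1} to position 2j+1 of C_i.  Every face
-- except the core is then a hexagon, all degrees are 2 or 3, and there are
-- k(n+1)² vertices and k(n+1)(3n+2)/2 edges.

ringOffset : ℕ → ℕ → ℕ
ringOffset k i = k ℕ.* i ℕ.* i

ringSize : ℕ → ℕ → ℕ
ringSize k i = k ℕ.* (2 ℕ.* i ℕ.+ 1)

cycleEdges : ℕ → ℕ → List (ℕ × ℕ)
cycleEdges k i =
  map (λ r → (o ℕ.+ r , o ℕ.+ suc r)) (upTo (sz ∸ 1)) ++ ((o ℕ.+ (sz ∸ 1) , o) ∷ [])
  where
    o  = ringOffset k i
    sz = ringSize k i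

spokeEdges : ℕ → ℕ → List (ℕ × ℕ)
spokeEdges k m =
  concatMap (λ s → map (λ j →
      ( ringOffset k m ℕ.+ s ℕ.* (2 ℕ.* m ℕ.+ 1) ℕ.+ 2 ℕ.* j
      , ringOffset k (suc m) ℕ.+ s ℕ.* (2 ℕ.* m ℕ.+ 3) ℕ.+ (2 ℕ.* j ℕ.+ 1)))
    (upTo (suc m)))
  (upTo k)

CNC : ℕ → ℕ → Graph
CNC k n = mkGraph (k ℕ.* (n ℕ.+ 1) ℕ.* (n ℕ.+ 1))
                  (concatMap (cycleEdges k) (upTo (suc n)) ++ concatMap (spokeEdges k) (upTo n))

module Indices {c ℓ} (F : EuclideanField c ℓ) where
  open EuclideanField F

  sq : Carrier → Carrier
  sq x = x * x

  edgeSum : List (ℕ × ℕ) → ((ℕ × ℕ) → Carrier) → Carrier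
  edgeSum es f = foldr (λ e acc → f e + acc) 0# es

  SO : Graph → Carrier
  SO G = edgeSum (edges G) λ { (a , b) →
           √ (sq ⟦ degree G a ⟧ + sq ⟦ degree G b ⟧) }

  SOred : Graph → Carrier
  SOred G = edgeSum (edges G) λ { (a , b) →
           √ (sq (⟦ degree G a ⟧ − 1#) + sq (⟦ degree G b ⟧ − 1#)) }

  avgDeg : Graph → Carrier
  avgDeg G = ⟦ 2 ℕ.* nE G ⟧ ÷ ⟦ nV G ⟧

  SOavr : Graph → Carrier
  SOavr G = edgeSum (edges G) λ { (a , b) →
           √ (sq (⟦ degree G a ⟧ − avgDeg G) + sq (⟦ degree G b ⟧ − avgDeg G)) }

module Submission where

-- Every vertex of CNC_k(n) has degree 3, except those at the even positions 0, 2, …, 2n of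
-- the k sectors of the outer cycle C_n, which have degree 2.  Degrees are computed by
-- counting occurrences in the edge list: a vertex gets 2 from its own cycle, and 1 from a
-- spoke if it sits at an even position of an inner cycle or at an odd position of C_i, i ≥ 1.
-- So the kn² edges of the inner cycles and the kn(n+1)/2 spokes all join two vertices of
-- degree 3, while each sector of C_n contributes n edges of each of the types (2,3), (3,2) and
-- one of type (2,2).  Any index I = Σ Φ(d_a, d_b) therefore satisfies
--   2 I = k (n(3n+1) Φ(3,3) + 2 (n (Φ(2,3) + Φ(3,2)) + Φ(2,2))),
-- and the weight Φ = 1 gives 2|E| = k(n+1)(3n+2), i.e. d̄ = (3n+2)/(n+1).  The three formulas
-- follow by evaluating the weights; square roots are identified by the uniqueness of
-- nonnegative square roots.

open import Defs
open import Data.Nat as ℕ using (ℕ)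
open import Data.Product using (_×_; _,_)

module Counting where
  open import Data.Nat using (zero; suc; _+_; _*_; _<_; _≤_; _≡ᵇ_)
  open import Data.Nat.Properties
  open import Data.Nat.DivMod using (_/_; _%_; m≡m%n+[m/n]*n; m%n<n; m<n*o⇒m/o<n)
  open import Data.Nat.ListAction using (sum)
  open import Data.Nat.ListAction.Properties using (sum-++)
  open import Data.List using ([]; _∷_; _++_; map; upTo)
  open import Data.List.Properties using (map-++; upTo-∷ʳ; map-upTo; map-applyUpTo)
  open import Data.Bool using (if_then_else_)
  open import Data.Product using (∃-syntax)
  open import Data.Sum using (_⊎_; inj₁; inj₂)
  open import Data.Empty using (⊥-elim)
  open import Relation.Binary using (tri<; tri≈; tri>)
  open import Relation.Binary.PropositionalEquality
  open import Data.Nat.Tactic.RingSolver using (solve-∀)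

  sumBelow : ℕ → (ℕ → ℕ) → ℕ
  sumBelow N g = sum (map g (upTo N))

  syntax sumBelow N (λ i → e) = ∑[ i < N ] e

  sumBelow-suc : ∀ N (g : ℕ → ℕ) → ∑[ i < suc N ] g i ≡ ∑[ i < N ] g i + g N
  sumBelow-suc N g = begin
    sum (map g (upTo (suc N)))        ≡⟨ cong (λ l → sum (map g l)) (sym (upTo-∷ʳ N)) ⟩
    sum (map g (upTo N ++ N ∷ []))    ≡⟨ cong sum (map-++ g (upTo N) (N ∷ [])) ⟩
    sum (map g (upTo N) ++ g N ∷ [])  ≡⟨ sum-++ (map g (upTo N)) (g N ∷ []) ⟩
    ∑[ i < N ] g i + (g N + 0)        ≡⟨ cong (∑[ i < N ] g i +_) (+-identityʳ (g N)) ⟩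
    ∑[ i < N ] g i + g N              ∎
    where open ≡-Reasoning

  sumBelow-sucˡ : ∀ N (g : ℕ → ℕ) → ∑[ i < suc N ] g i ≡ g 0 + ∑[ i < N ] g (suc i)
  sumBelow-sucˡ N g =
    cong (λ l → g 0 + sum l) (trans (map-applyUpTo suc g N) (sym (map-upTo (λ i → g (suc i)) N)))

  sumBelow-cong : ∀ N (g h : ℕ → ℕ) → (∀ i → i < N → g i ≡ h i) → ∑[ i < N ] g i ≡ ∑[ i < N ] h i
  sumBelow-cong zero    g h e = refl
  sumBelow-cong (suc N) g h e = begin
    ∑[ i < suc N ] g i    ≡⟨ sumBelow-suc N g ⟩
    ∑[ i < N ] g i + g N  ≡⟨ cong₂ _+_ (sumBelow-cong N g h (λ i i<N → e i (m<n⇒m<1+n i<N))) (e N ≤-refl) ⟩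
    ∑[ i < N ] h i + h N  ≡⟨ sumBelow-suc N h ⟨
    ∑[ i < suc N ] h i    ∎
    where open ≡-Reasoning

  sumBelow-+ : ∀ N (g h : ℕ → ℕ) → ∑[ i < N ] (g i + h i) ≡ ∑[ i < N ] g i + ∑[ i < N ] h i
  sumBelow-+ zero    g h = refl
  sumBelow-+ (suc N) g h = begin
    ∑[ i < suc N ] (g i + h i)                       ≡⟨ sumBelow-suc N _ ⟩
    ∑[ i < N ] (g i + h i) + (g N + h N)             ≡⟨ cong (_+ (g N + h N)) (sumBelow-+ N g h) ⟩
    (∑[ i < N ] g i + ∑[ i < N ] h i) + (g N + h N)  ≡⟨ +-+-comm (∑[ i < N ] g i) _ (g N) (h N) ⟩
    (∑[ i < N ] g i + g N) + (∑[ i < N ] h i + h N)  ≡⟨ cong₂ _+_ (sumBelow-suc N g) (sumBelow-suc N h) ⟨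
    ∑[ i < suc N ] g i + ∑[ i < suc N ] h i          ∎
    where
    open ≡-Reasoning
    +-+-comm : ∀ a b c d → (a + b) + (c + d) ≡ (a + c) + (b + d)
    +-+-comm = solve-∀

  sumBelow-≡0 : ∀ N (g : ℕ → ℕ) → (∀ i → i < N → g i ≡ 0) → ∑[ i < N ] g i ≡ 0
  sumBelow-≡0 zero    g z = refl
  sumBelow-≡0 (suc N) g z = begin
    ∑[ i < suc N ] g i    ≡⟨ sumBelow-suc N g ⟩
    ∑[ i < N ] g i + g N  ≡⟨ cong₂ _+_ (sumBelow-≡0 N g (λ i i<N → z i (m<n⇒m<1+n i<N))) (z N ≤-refl) ⟩
    0                     ∎
    where open ≡-Reasoning

  sumBelow-single : ∀ N (g : ℕ → ℕ) {i₀} → i₀ < N → (∀ i → i < N → i ≢ i₀ → g i ≡ 0) →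
                    ∑[ i < N ] g i ≡ g i₀
  sumBelow-single (suc N) g {i₀} i₀<1+N z with <-cmp i₀ N
  ... | tri< i₀<N _ _ = begin
    ∑[ i < suc N ] g i    ≡⟨ sumBelow-suc N g ⟩
    ∑[ i < N ] g i + g N  ≡⟨ cong₂ _+_ (sumBelow-single N g i₀<N (λ i i<N → z i (m<n⇒m<1+n i<N)))
                                      (z N ≤-refl (>⇒≢ i₀<N)) ⟩
    g i₀ + 0              ≡⟨ +-identityʳ (g i₀) ⟩
    g i₀                  ∎
    where open ≡-Reasoning
  ... | tri≈ _ refl _ = begin
    ∑[ i < suc N ] g i    ≡⟨ sumBelow-suc N g ⟩
    ∑[ i < N ] g i + g N  ≡⟨ cong (_+ g N) (sumBelow-≡0 N g (λ i i<N → z i (m<n⇒m<1+n i<N) (<⇒≢ i<N))) ⟩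
    g N                   ∎
    where open ≡-Reasoning
  ... | tri> _ _ i₀>N = ⊥-elim (<⇒≱ i₀>N (≤-pred i₀<1+N))

  δ : ℕ → ℕ → ℕ
  δ x v = if x ≡ᵇ v then 1 else 0

  δ-refl : ∀ v → δ v v ≡ 1
  δ-refl zero    = refl
  δ-refl (suc v) = δ-refl v

  δ-≢ : ∀ x v → x ≢ v → δ x v ≡ 0
  δ-≢ zero    zero    x≢v = ⊥-elim (x≢v refl)
  δ-≢ zero    (suc v) x≢v = refl
  δ-≢ (suc x) zero    x≢v = refl
  δ-≢ (suc x) (suc v) x≢v = δ-≢ x v (λ x≡v → x≢v (cong suc x≡v))

  δ-+ˡ : ∀ a x y → δ (a + x) (a + y) ≡ δ x y
  δ-+ˡ zero    x y = refl
  δ-+ˡ (suc a) x y = δ-+ˡ a x y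

  ∑δ-miss : ∀ N (f : ℕ → ℕ) v → (∀ i → i < N → f i ≢ v) → ∑[ i < N ] δ (f i) v ≡ 0
  ∑δ-miss N f v miss = sumBelow-≡0 N (λ i → δ (f i) v) (λ i i<N → δ-≢ (f i) v (miss i i<N))

  ∑δ-outside : ∀ N O v → v < O ⊎ O + N ≤ v → ∑[ r < N ] δ (O + r) v ≡ 0
  ∑δ-outside N O v v-out = ∑δ-miss N (O +_) v (λ r r<N → point≢v r r<N v-out)
    where
    point≢v : ∀ r → r < N → v < O ⊎ O + N ≤ v → O + r ≢ v
    point≢v r _   (inj₁ v<O)   refl = <⇒≱ v<O (m≤m+n O r)
    point≢v r r<N (inj₂ v≥end) refl = <⇒≱ (+-monoʳ-< O r<N) v≥end

  ∑δ-hit : ∀ N (f : ℕ → ℕ) {i₀} → i₀ < N → (∀ i → i < N → f i ≡ f i₀ → i ≡ i₀) →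
           ∑[ i < N ] δ (f i) (f i₀) ≡ 1
  ∑δ-hit N f {i₀} i₀<N inj = trans
    (sumBelow-single N (λ i → δ (f i) (f i₀)) i₀<N (λ i i<N i≢i₀ → δ-≢ (f i) (f i₀) (λ e → i≢i₀ (inj i i<N e))))
    (δ-refl (f i₀))

  radix-< : ∀ R {s s'} x x' → s < s' → x < R → s * R + x < s' * R + x'
  radix-< R {s} {s'} x x' s<s' x<R = begin-strict
    s * R + x    <⟨ +-monoʳ-< (s * R) x<R ⟩
    s * R + R    ≡⟨ +-comm (s * R) R ⟩
    suc s * R    ≤⟨ *-monoˡ-≤ R s<s' ⟩
    s' * R       ≤⟨ m≤m+n (s' * R) x' ⟩
    s' * R + x'  ∎
    where open ≤-Reasoning

  radix-bound : ∀ R {K s x} → s < K → x < R → s * R + x < K * R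
  radix-bound R {K} {s} {x} s<K x<R = subst (s * R + x <_) (+-identityʳ (K * R)) (radix-< R x 0 s<K x<R)

  radix-injective : ∀ R {s s' x x'} → x < R → x' < R → s * R + x ≡ s' * R + x' → s ≡ s'
  radix-injective R {s} {s'} {x} {x'} x<R x'<R e with <-cmp s s'
  ... | tri< s<s' _ _ = ⊥-elim (<-irrefl e (radix-< R x x' s<s' x<R))
  ... | tri≈ _ s≡s' _ = s≡s'
  ... | tri> _ _ s>s' = ⊥-elim (<-irrefl (sym e) (radix-< R x' x s>s' x'<R))

  radix-decompose : ∀ K R t → 0 < R → t < K * R →
                    ∃[ s ] ∃[ p ] (s < K × p < R × t ≡ s * R + p)
  radix-decompose K (suc R) t _ t<KR = t / suc R , t % suc R , m<n*o⇒m/o<n t<KR , m%n<n t (suc R) ,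
    trans (m≡m%n+[m/n]*n t (suc R)) (+-comm (t % suc R) _)

  even-or-odd : ∀ p → ∃[ j ] (p ≡ 2 * j ⊎ p ≡ 2 * j + 1)
  even-or-odd zero = 0 , inj₁ refl
  even-or-odd (suc p) with even-or-odd p
  ... | j , inj₁ refl = j , inj₂ (+-comm 1 (2 * j))
  ... | j , inj₂ refl = suc j , inj₁ (1+odd j)
    where
    1+odd : ∀ j → suc (2 * j + 1) ≡ 2 * suc j
    1+odd = solve-∀

  periodicCount : (K J O R : ℕ) → (ℕ → ℕ) → ℕ → ℕ
  periodicCount K J O R π v = ∑[ s < K ] ∑[ j < J ] δ (O + s * R + π j) v

  periodicCount-outside : ∀ K J O R π v → (∀ j → j < J → π j < R) → v < O ⊎ O + K * R ≤ v →
                          periodicCount K J O R π v ≡ 0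
  periodicCount-outside K J O R π v π<R v-out =
    sumBelow-≡0 K _ (λ s s<K → ∑δ-miss J (λ j → O + s * R + π j) v (λ j j<J → point≢v s j s<K j<J v-out))
    where
    point≢v : ∀ s j → s < K → j < J → v < O ⊎ O + K * R ≤ v → O + s * R + π j ≢ v
    point≢v s j _   _   (inj₁ v<O) refl = <⇒≱ v<O (≤-trans (m≤m+n O (s * R)) (m≤m+n (O + s * R) (π j)))
    point≢v s j s<K j<J (inj₂ v≥end) refl = <⇒≱ (begin-strict
      O + s * R + π j    ≡⟨ +-assoc O (s * R) (π j) ⟩
      O + (s * R + π j)  <⟨ +-monoʳ-< O (radix-bound R s<K (π<R j j<J)) ⟩
      O + K * R          ∎) v≥end
      where open ≤-Reasoning

  periodicCount-inside : ∀ K J O R π {s₀ p} → s₀ < K → p < R → (∀ j → j < J → π j < R) →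
                         periodicCount K J O R π (O + (s₀ * R + p)) ≡ ∑[ j < J ] δ (π j) p
  periodicCount-inside K J O R π {s₀} {p} s₀<K p<R π<R = begin
    periodicCount K J O R π v
      ≡⟨ sumBelow-single K _ s₀<K (λ s _ s≢s₀ → ∑δ-miss J (λ j → O + s * R + π j) v
           (λ j j<J e → s≢s₀ (radix-injective R (π<R j j<J) p<R
              (+-cancelˡ-≡ O _ _ (trans (sym (+-assoc O (s * R) (π j))) e))))) ⟩
    ∑[ j < J ] δ (O + s₀ * R + π j) v
      ≡⟨ sumBelow-cong J _ _ (λ j _ → begin
           δ (O + s₀ * R + π j) v        ≡⟨ cong (λ x → δ x v) (+-assoc O (s₀ * R) (π j)) ⟩
           δ (O + (s₀ * R + π j)) v      ≡⟨ δ-+ˡ O _ _ ⟩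
           δ (s₀ * R + π j) (s₀ * R + p) ≡⟨ δ-+ˡ (s₀ * R) _ _ ⟩
           δ (π j) p                     ∎) ⟩
    ∑[ j < J ] δ (π j) p ∎
    where
    open ≡-Reasoning
    v : ℕ
    v = O + (s₀ * R + p)

  evens-hit : ∀ J {j₀} → j₀ < J → ∑[ j < J ] δ (2 * j) (2 * j₀) ≡ 1
  evens-hit J j₀<J = ∑δ-hit J (2 *_) j₀<J (λ i _ → *-cancelˡ-≡ _ _ 2)

  odds-hit : ∀ J {j₀} → j₀ < J → ∑[ j < J ] δ (2 * j + 1) (2 * j₀ + 1) ≡ 1
  odds-hit J j₀<J = ∑δ-hit J (λ j → 2 * j + 1) j₀<J (λ i _ e → *-cancelˡ-≡ _ _ 2 (+-cancelʳ-≡ 1 _ _ e))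

  2a≢2b+1 : ∀ a b → 2 * a ≢ 2 * b + 1
  2a≢2b+1 a b e = even≢odd a b (trans e (+-comm (2 * b) 1))

  evens-miss-odd : ∀ J j₀ → ∑[ j < J ] δ (2 * j) (2 * j₀ + 1) ≡ 0
  evens-miss-odd J j₀ = ∑δ-miss J (2 *_) _ (λ j _ → 2a≢2b+1 j j₀)

  odds-miss-even : ∀ J j₀ → ∑[ j < J ] δ (2 * j + 1) (2 * j₀) ≡ 0
  odds-miss-even J j₀ = ∑δ-miss J (λ j → 2 * j + 1) _ (λ j _ e → 2a≢2b+1 j₀ j (sym e))

module EdgeListDegree where
  open import Data.Nat using (_+_)
  open import Data.Nat.Properties using (+-assoc)
  open import Data.Nat.ListAction using (sum)
  open import Data.List using (List; []; _∷_; _++_; map; concatMap)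
  open import Relation.Binary.PropositionalEquality
  open Counting using (δ)

  -- degree never inspects the vertex count, so the 0 below is immaterial.
  degreeIn : List (ℕ × ℕ) → ℕ → ℕ
  degreeIn es v = degree (mkGraph 0 es) v

  degreeIn-++ : ∀ xs ys v → degreeIn (xs ++ ys) v ≡ degreeIn xs v + degreeIn ys v
  degreeIn-++ []             ys v = refl
  degreeIn-++ ((a , b) ∷ xs) ys v =
    trans (cong (δ a v + δ b v +_) (degreeIn-++ xs ys v)) (sym (+-assoc (δ a v + δ b v) _ _))

  degreeIn-concatMap : ∀ {A : Set} (h : A → List (ℕ × ℕ)) xs v →
                       degreeIn (concatMap h xs) v ≡ sum (map (λ x → degreeIn (h x) v) xs)
  degreeIn-concatMap h []       v = refl
  degreeIn-concatMap h (x ∷ xs) v =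
    trans (degreeIn-++ (h x) (concatMap h xs) v) (cong (degreeIn (h x) v +_) (degreeIn-concatMap h xs v))

  degreeIn-map : ∀ {A : Set} (f g : A → ℕ) xs v →
                 degreeIn (map (λ x → (f x , g x)) xs) v ≡ sum (map (λ x → δ (f x) v + δ (g x) v) xs)
  degreeIn-map f g []       v = refl
  degreeIn-map f g (x ∷ xs) v = cong (δ (f x) v + δ (g x) v +_) (degreeIn-map f g xs v)

module NanoconeDegrees (k n : ℕ) (k≥1 : 1 ℕ.≤ k) where
  open import Data.Nat using (zero; suc; _+_; _*_; _∸_; _<_; _≤_; _≟_; z≤n; s≤s)
  open import Data.Nat.Properties
  open import Data.List using ([]; _∷_; map; concatMap; upTo)
  open import Data.Sum using (_⊎_; inj₁; inj₂)
  open import Data.Empty using (⊥-elim)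
  open import Relation.Nullary using (yes; no)
  open import Relation.Binary using (tri<; tri≈; tri>)
  open import Relation.Binary.PropositionalEquality
  open import Data.Nat.Tactic.RingSolver using (solve-∀)
  open Counting
  open EdgeListDegree

  offset : ℕ → ℕ
  offset = ringOffset k

  size : ℕ → ℕ
  size = ringSize k

  deg : ℕ → ℕ
  deg = degree (CNC k n)

  offset-suc : ∀ i → offset (suc i) ≡ offset i + size i
  offset-suc = identity k
    where
    identity : ∀ k i → k * suc i * suc i ≡ k * i * i + k * (2 * i + 1)
    identity = solve-∀

  size≥1 : ∀ i → 1 ≤ size i
  size≥1 i = *-mono-≤ k≥1 (m≤n+m 1 (2 * i))

  suc-pred-size : ∀ i → suc (size i ∸ 1) ≡ size i
  suc-pred-size i = trans (+-comm 1 _) (m∸n+n≡m (size≥1 i))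

  rings-ordered : ∀ {i j} → i < j → offset i + size i ≤ offset j
  rings-ordered {i} {j} i<j = subst (_≤ offset j) (offset-suc i) (*-mono-≤ (*-monoʳ-≤ k i<j) i<j)

  outside-ring : ∀ {i j t} → t < size i → j ≢ i → offset i + t < offset j ⊎ offset j + size j ≤ offset i + t
  outside-ring {i} {j} {t} t<size j≢i with <-cmp i j
  ... | tri< i<j _ _ = inj₁ (<-≤-trans (+-monoʳ-< (offset i) t<size) (rings-ordered i<j))
  ... | tri≈ _ i≡j _ = ⊥-elim (j≢i (sym i≡j))
  ... | tri> _ _ i>j = inj₂ (≤-trans (rings-ordered i>j) (m≤m+n (offset i) t))

  ringCount : ℕ → ℕ → ℕ
  ringCount i v = ∑[ r < size i ] δ (offset i + r) v

  cycle-degree : ∀ i v → degreeIn (cycleEdges k i) v ≡ ringCount i v + ringCount i v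
  cycle-degree i v = begin
      degreeIn (cycleEdges k i) v
    ≡⟨ degreeIn-++ (map (λ r → (o + r , o + suc r)) (upTo N)) ((o + N , o) ∷ []) v ⟩
      degreeIn (map (λ r → (o + r , o + suc r)) (upTo N)) v + ((A N + δ o v) + 0)
    ≡⟨ cong (_+ ((A N + δ o v) + 0)) (trans (degreeIn-map (o +_) (λ r → o + suc r) (upTo N) v) (sumBelow-+ N _ _)) ⟩
      (∑[ r < N ] A r + ∑[ r < N ] A (suc r)) + ((A N + δ o v) + 0)
    ≡⟨ rearrange (∑[ r < N ] A r) (∑[ r < N ] A (suc r)) (A N) (δ o v) ⟩
      (∑[ r < N ] A r + A N) + (δ o v + ∑[ r < N ] A (suc r))
    ≡⟨ cong₂ _+_ (sumBelow-suc N A) (cong (λ x → δ x v + ∑[ r < N ] A (suc r)) (+-identityʳ o)) ⟨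
      ∑[ r < suc N ] A r + (A 0 + ∑[ r < N ] A (suc r))
    ≡⟨ cong (∑[ r < suc N ] A r +_) (sumBelow-sucˡ N A) ⟨
      ∑[ r < suc N ] A r + ∑[ r < suc N ] A r
    ≡⟨ cong (λ m → ∑[ r < m ] A r + ∑[ r < m ] A r) (suc-pred-size i) ⟩
      ringCount i v + ringCount i v
    ∎
    where
    open ≡-Reasoning
    o N : ℕ
    o = offset i
    N = size i ∸ 1
    A : ℕ → ℕ
    A r = δ (o + r) v
    rearrange : ∀ a b c d → (a + b) + ((c + d) + 0) ≡ (a + c) + (d + b)
    rearrange = solve-∀

  ringCount-hit : ∀ {i t} → t < size i → ringCount i (offset i + t) ≡ 1
  ringCount-hit {i} t<size = ∑δ-hit (size i) (offset i +_) t<size (λ r _ → +-cancelˡ-≡ (offset i) r _)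

  ringCount-miss : ∀ {i j t} → t < size i → j ≢ i → ringCount j (offset i + t) ≡ 0
  ringCount-miss {i} {j} t<size j≢i = ∑δ-outside (size j) (offset j) _ (outside-ring t<size j≢i)

  cycles-degree : ∀ {i t} → i ≤ n → t < size i → ∑[ j < suc n ] degreeIn (cycleEdges k j) (offset i + t) ≡ 2
  cycles-degree {i} {t} i≤n t<size = begin
    ∑[ j < suc n ] degreeIn (cycleEdges k j) v
      ≡⟨ sumBelow-single (suc n) _ (s≤s i≤n) (λ j _ j≢i →
           trans (cycle-degree j v) (cong₂ _+_ (ringCount-miss t<size j≢i) (ringCount-miss t<size j≢i))) ⟩
    degreeIn (cycleEdges k i) v    ≡⟨ cycle-degree i v ⟩
    ringCount i v + ringCount i v  ≡⟨ cong₂ _+_ (ringCount-hit t<size) (ringCount-hit t<size) ⟩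
    2                              ∎
    where
    open ≡-Reasoning
    v : ℕ
    v = offset i + t

  inward : ℕ → ℕ → ℕ
  inward m = periodicCount k (suc m) (offset m) (2 * m + 1) (2 *_)

  outward : ℕ → ℕ → ℕ
  outward m = periodicCount k (suc m) (offset (suc m)) (2 * m + 3) (λ j → 2 * j + 1)

  spoke-degree : ∀ m v → degreeIn (spokeEdges k m) v ≡ inward m v + outward m v
  spoke-degree m v = begin
    degreeIn (spokeEdges k m) v
      ≡⟨ degreeIn-concatMap (λ s → map (λ j → (in-end s j , out-end s j)) (upTo (suc m))) (upTo k) v ⟩
    ∑[ s < k ] degreeIn (map (λ j → (in-end s j , out-end s j)) (upTo (suc m))) v
      ≡⟨ sumBelow-cong k _ _ (λ s _ →
           trans (degreeIn-map (in-end s) (out-end s) (upTo (suc m)) v)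
                 (sumBelow-+ (suc m) (λ j → δ (in-end s j) v) (λ j → δ (out-end s j) v))) ⟩
    ∑[ s < k ] (∑[ j < suc m ] δ (in-end s j) v + ∑[ j < suc m ] δ (out-end s j) v)
      ≡⟨ sumBelow-+ k (λ s → ∑[ j < suc m ] δ (in-end s j) v) (λ s → ∑[ j < suc m ] δ (out-end s j) v) ⟩
    inward m v + outward m v
      ∎
    where
    open ≡-Reasoning
    in-end out-end : ℕ → ℕ → ℕ
    in-end  s j = offset m + s * (2 * m + 1) + 2 * j
    out-end s j = offset (suc m) + s * (2 * m + 3) + (2 * j + 1)

  degree-split : ∀ v → deg v ≡ ∑[ j < suc n ] degreeIn (cycleEdges k j) v + ∑[ m < n ] (inward m v + outward m v)
  degree-split v = begin
    deg v
      ≡⟨ degreeIn-++ (concatMap (cycleEdges k) (upTo (suc n))) (concatMap (spokeEdges k) (upTo n)) v ⟩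
    degreeIn (concatMap (cycleEdges k) (upTo (suc n))) v + degreeIn (concatMap (spokeEdges k) (upTo n)) v
      ≡⟨ cong₂ _+_ (degreeIn-concatMap (cycleEdges k) (upTo (suc n)) v)
                   (trans (degreeIn-concatMap (spokeEdges k) (upTo n) v) (sumBelow-cong n _ _ (λ m _ → spoke-degree m v))) ⟩
    ∑[ j < suc n ] degreeIn (cycleEdges k j) v + ∑[ m < n ] (inward m v + outward m v)
      ∎
    where open ≡-Reasoning

  twice-inner-edges : ∀ m → 2 * (∑[ i < m ] size i + ∑[ j < m ] (k * suc j)) ≡ k * m * (3 * m + 1)
  twice-inner-edges zero    = base k
    where
    base : ∀ k → 0 ≡ k * 0 * (3 * 0 + 1)
    base = solve-∀
  twice-inner-edges (suc m) = begin
    2 * (∑[ i < suc m ] size i + ∑[ j < suc m ] (k * suc j))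
      ≡⟨ cong₂ (λ a b → 2 * (a + b)) (sumBelow-suc m size) (sumBelow-suc m (λ j → k * suc j)) ⟩
    2 * ((S + size m) + (T + k * suc m))  ≡⟨ regroup S T (size m) (k * suc m) ⟩
    2 * (S + T) + 2 * (size m + k * suc m) ≡⟨ cong (_+ 2 * (size m + k * suc m)) (twice-inner-edges m) ⟩
    k * m * (3 * m + 1) + 2 * (k * (2 * m + 1) + k * suc m) ≡⟨ step k m ⟩
    k * suc m * (3 * suc m + 1) ∎
    where
    open ≡-Reasoning
    S T : ℕ
    S = ∑[ i < m ] size i
    T = ∑[ j < m ] (k * suc j)
    regroup : ∀ S T a b → 2 * ((S + a) + (T + b)) ≡ 2 * (S + T) + 2 * (a + b)
    regroup = solve-∀
    step : ∀ k m → k * m * (3 * m + 1) + 2 * (k * (2 * m + 1) + k * suc m) ≡ k * suc m * (3 * suc m + 1)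
    step = solve-∀

  vertex : ℕ → ℕ → ℕ → ℕ
  vertex i s p = offset i + (s * (2 * i + 1) + p)

  2j<2m+1 : ∀ {m j} → j < suc m → 2 * j < 2 * m + 1
  2j<2m+1 {m} j≤m = ≤-<-trans (*-monoʳ-≤ 2 (≤-pred j≤m)) (m<m+n (2 * m) (s≤s z≤n))

  2j+1<2m+1 : ∀ {m j} → j < m → 2 * j + 1 < 2 * m + 1
  2j+1<2m+1 j<m = +-monoˡ-< 1 (*-monoʳ-< 2 j<m)

  2j+1<2m+3 : ∀ {m j} → j < suc m → 2 * j + 1 < 2 * m + 3
  2j+1<2m+3 j≤m = +-mono-≤-< (*-monoʳ-≤ 2 (≤-pred j≤m)) (s≤s (s≤s z≤n))

  2[1+m]+1≡2m+3 : ∀ m → 2 * suc m + 1 ≡ 2 * m + 3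
  2[1+m]+1≡2m+3 = solve-∀

  module AtVertex (i s p : ℕ) (s<k : s < k) (p<2i+1 : p < 2 * i + 1) where

    v : ℕ
    v = vertex i s p

    position<size : s * (2 * i + 1) + p < size i
    position<size = radix-bound (2 * i + 1) s<k p<2i+1

    inward-elsewhere : ∀ m → m ≢ i → inward m v ≡ 0
    inward-elsewhere m m≢i = periodicCount-outside k (suc m) (offset m) (2 * m + 1) (2 *_) v
      (λ j → 2j<2m+1) (outside-ring position<size m≢i)

    inward-here : inward i v ≡ ∑[ j < suc i ] δ (2 * j) p
    inward-here = periodicCount-inside k (suc i) (offset i) (2 * i + 1) (2 *_) s<k p<2i+1 (λ j → 2j<2m+1)

    outward-elsewhere : ∀ m → suc m ≢ i → outward m v ≡ 0
    outward-elsewhere m 1+m≢i = periodicCount-outside k (suc m) (offset (suc m)) (2 * m + 3) (λ j → 2 * j + 1) v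
      (λ j → 2j+1<2m+3)
      (subst (λ w → v < offset (suc m) ⊎ offset (suc m) + k * w ≤ v) (2[1+m]+1≡2m+3 m)
             (outside-ring position<size 1+m≢i))

  outward-here : ∀ m s p → s < k → p < 2 * suc m + 1 →
                 outward m (vertex (suc m) s p) ≡ ∑[ j < suc m ] δ (2 * j + 1) p
  outward-here m s p s<k p<2m+3 rewrite 2[1+m]+1≡2m+3 m =
    periodicCount-inside k (suc m) (offset (suc m)) (2 * m + 3) (λ j → 2 * j + 1) s<k p<2m+3 (λ j → 2j+1<2m+3)

  degree-vertex : ∀ {i s p} → i ≤ n → s < k → p < 2 * i + 1 →
                  deg (vertex i s p) ≡ 2 + ∑[ m < n ] (inward m (vertex i s p) + outward m (vertex i s p))
  degree-vertex {i} {s} {p} i≤n s<k p<2i+1 =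
    trans (degree-split v) (cong (_+ ∑[ m < n ] (inward m v + outward m v)) (cycles-degree i≤n position<size))
    where open AtVertex i s p s<k p<2i+1

  outward-even : ∀ {i s j} m → s < k → j < suc i → outward m (vertex i s (2 * j)) ≡ 0
  outward-even {i} {s} {j} m s<k j≤i with suc m ≟ i
  ... | yes refl = trans (outward-here m s (2 * j) s<k (2j<2m+1 j≤i)) (odds-miss-even (suc m) j)
  ... | no 1+m≢i = AtVertex.outward-elsewhere i s (2 * j) s<k (2j<2m+1 j≤i) m 1+m≢i

  inward-odd : ∀ {i s j} m → s < k → j < i → inward m (vertex i s (2 * j + 1)) ≡ 0
  inward-odd {i} {s} {j} m s<k j<i with m ≟ i
  ... | yes refl = trans (AtVertex.inward-here m s (2 * j + 1) s<k (2j+1<2m+1 j<i)) (evens-miss-odd (suc m) j)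
  ... | no m≢i = AtVertex.inward-elsewhere i s (2 * j + 1) s<k (2j+1<2m+1 j<i) m m≢i

  degree-even-inner : ∀ {i s j} → i < n → s < k → j < suc i → deg (vertex i s (2 * j)) ≡ 3
  degree-even-inner {i} {s} {j} i<n s<k j≤i = begin
    deg v                                      ≡⟨ degree-vertex (<⇒≤ i<n) s<k (2j<2m+1 j≤i) ⟩
    2 + ∑[ m < n ] (inward m v + outward m v)  ≡⟨ cong (2 +_) (sumBelow-single n _ i<n (λ m _ m≢i →
                                                    cong₂ _+_ (inward-elsewhere m m≢i) (outward-even m s<k j≤i))) ⟩
    2 + (inward i v + outward i v)             ≡⟨ cong₂ (λ a b → 2 + (a + b))
                                                    (trans inward-here (evens-hit (suc i) j≤i)) (outward-even i s<k j≤i) ⟩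
    3                                          ∎
    where
    open ≡-Reasoning
    open AtVertex i s (2 * j) s<k (2j<2m+1 j≤i)

  degree-even-outer : ∀ {s j} → s < k → j < suc n → deg (vertex n s (2 * j)) ≡ 2
  degree-even-outer {s} {j} s<k j≤n = begin
    deg v                                      ≡⟨ degree-vertex ≤-refl s<k (2j<2m+1 j≤n) ⟩
    2 + ∑[ m < n ] (inward m v + outward m v)  ≡⟨ cong (2 +_) (sumBelow-≡0 n _ (λ m m<n →
                                                    cong₂ _+_ (inward-elsewhere m (<⇒≢ m<n)) (outward-even m s<k j≤n))) ⟩
    2                                          ∎
    where
    open ≡-Reasoning
    open AtVertex n s (2 * j) s<k (2j<2m+1 j≤n)

  degree-odd : ∀ {i s j} → i ≤ n → s < k → j < i → deg (vertex i s (2 * j + 1)) ≡ 3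
  degree-odd {suc i} {s} {j} i<n s<k j≤i = begin
    deg v                                      ≡⟨ degree-vertex i<n s<k (2j+1<2m+1 j≤i) ⟩
    2 + ∑[ m < n ] (inward m v + outward m v)  ≡⟨ cong (2 +_) (sumBelow-single n _ i<n (λ m _ m≢i →
                                                    cong₂ _+_ (inward-odd m s<k j≤i)
                                                              (outward-elsewhere m (λ e → m≢i (suc-injective e))))) ⟩
    2 + (inward i v + outward i v)             ≡⟨ cong₂ (λ a b → 2 + (a + b)) (inward-odd i s<k j≤i)
                                                    (trans (outward-here i s (2 * j + 1) s<k (2j+1<2m+1 j≤i))
                                                           (odds-hit (suc i) j≤i)) ⟩
    3                                          ∎
    where
    open ≡-Reasoning
    open AtVertex (suc i) s (2 * j + 1) s<k (2j+1<2m+1 j≤i)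

  2j<2i+1⇒j<1+i : ∀ {i} j → 2 * j < 2 * i + 1 → j < suc i
  2j<2i+1⇒j<1+i {i} j 2j<2i+1 = s≤s (*-cancelˡ-≤ 2 (≤-pred (subst (2 * j <_) (+-comm (2 * i) 1) 2j<2i+1)))

  2j+1<2i+1⇒j<i : ∀ {i} j → 2 * j + 1 < 2 * i + 1 → j < i
  2j+1<2i+1⇒j<i {i} j 2j+1<2i+1 = *-cancelˡ-< 2 j i (+-cancelʳ-< 1 (2 * j) (2 * i) 2j+1<2i+1)

  degree-inner-ring : ∀ {i t} → i < n → t < size i → deg (offset i + t) ≡ 3
  degree-inner-ring {i} {t} i<n t<size with radix-decompose k (2 * i + 1) t (m≤n+m 1 (2 * i)) t<size
  ... | s , p , s<k , p<2i+1 , refl with even-or-odd p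
  ...   | j , inj₁ refl = degree-even-inner i<n s<k (2j<2i+1⇒j<1+i j p<2i+1)
  ...   | j , inj₂ refl = degree-odd (<⇒≤ i<n) s<k (2j+1<2i+1⇒j<i j p<2i+1)

  spoke-inner-end : ∀ {m s j} → m < n → s < k → j < suc m → deg (offset m + s * (2 * m + 1) + 2 * j) ≡ 3
  spoke-inner-end {m} m<n s<k j≤m = trans (cong deg (+-assoc (offset m) _ _)) (degree-even-inner m<n s<k j≤m)

  spoke-outer-end : ∀ {m s j} → m < n → s < k → j < suc m →
                    deg (offset (suc m) + s * (2 * m + 3) + (2 * j + 1)) ≡ 3
  spoke-outer-end {m} {s} {j} m<n s<k j≤m = begin
    deg (offset (suc m) + s * (2 * m + 3) + (2 * j + 1))    ≡⟨ cong deg (+-assoc (offset (suc m)) _ _) ⟩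
    deg (offset (suc m) + (s * (2 * m + 3) + (2 * j + 1)))  ≡⟨ cong (λ w → deg (offset (suc m) + (s * w + (2 * j + 1))))
                                                                    (2[1+m]+1≡2m+3 m) ⟨
    deg (vertex (suc m) s (2 * j + 1))                      ≡⟨ degree-odd m<n s<k j≤m ⟩
    3                                                       ∎
    where open ≡-Reasoning

module FieldFacts {c ℓ} (F : EuclideanField c ℓ) where
  open import Data.Nat using (zero; suc)
  open import Algebra using (RawRing)
  open import Algebra.Solver.Ring.AlmostCommutativeRing
    using (AlmostCommutativeRing; fromCommutativeSemiring; _-Raw-AlmostCommutative⟶_)
  import Algebra.Properties.Group as GroupProperties
  open import Relation.Binary.Structures using (IsTotalOrder)
  open import Data.Sum using (inj₁; inj₂)
  open import Data.Maybe using (Maybe; just; nothing)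
  open import Relation.Nullary using (yes; no)
  import Relation.Binary.PropositionalEquality as ≡
  open import Function using (id)

  open EuclideanField F public
  open import Relation.Binary.Reasoning.Setoid setoid public
  open IsTotalOrder isTotalOrder public using (total; antisym)
    renaming (trans to ≤-trans; reflexive to ≤-reflexive; ≲-respˡ-≈ to ≤-respˡ-≈; ≲-respʳ-≈ to ≤-respʳ-≈)
  open GroupProperties +-group using (x≈z//y)

  ⟦+⟧ : ∀ m n → ⟦ m ℕ.+ n ⟧ ≈ ⟦ m ⟧ + ⟦ n ⟧
  ⟦+⟧ zero    n = sym (+-identityˡ _)
  ⟦+⟧ (suc m) n = trans (+-congˡ (⟦+⟧ m n)) (sym (+-assoc _ _ _))

  ⟦*⟧ : ∀ m n → ⟦ m ℕ.* n ⟧ ≈ ⟦ m ⟧ * ⟦ n ⟧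
  ⟦*⟧ zero    n = sym (zeroˡ _)
  ⟦*⟧ (suc m) n = begin
    ⟦ n ℕ.+ m ℕ.* n ⟧         ≈⟨ ⟦+⟧ n (m ℕ.* n) ⟩
    ⟦ n ⟧ + ⟦ m ℕ.* n ⟧       ≈⟨ +-congˡ (⟦*⟧ m n) ⟩
    ⟦ n ⟧ + ⟦ m ⟧ * ⟦ n ⟧     ≈⟨ +-congʳ (*-identityˡ _) ⟨
    1# * ⟦ n ⟧ + ⟦ m ⟧ * ⟦ n ⟧ ≈⟨ distribʳ _ _ _ ⟨
    (1# + ⟦ m ⟧) * ⟦ n ⟧      ∎

  ⟦suc⟧-* : ∀ m x → ⟦ suc m ⟧ * x ≈ ⟦ m ⟧ * x + x
  ⟦suc⟧-* m x = trans (distribʳ x 1# ⟦ m ⟧) (trans (+-congʳ (*-identityˡ x)) (+-comm x _))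

  ⟦⟧-cong : ∀ {m n} → m ≡.≡ n → ⟦ m ⟧ ≈ ⟦ n ⟧
  ⟦⟧-cong ≡.refl = refl

  ⟦1⟧ : ⟦ 1 ⟧ ≈ 1#
  ⟦1⟧ = +-identityʳ 1#

  -- Ring solver with coefficients ℕ read through ⟦_⟧.  It is built on the semiring reduct,
  -- whose negation is the identity, so terms with − are first rewritten by −-unique and
  -- square-−.  Moreover con m is ⟦ m ⟧, so con 1 is 1# + 0#: a 1# that must stay literal
  -- is passed to the solver as a variable.
  private
    ℕ-rawRing : RawRing _ _
    ℕ-rawRing = record
      { Carrier = ℕ ; _≈_ = ≡._≡_ ; _+_ = ℕ._+_ ; _*_ = ℕ._*_ ; -_ = id ; 0# = 0 ; 1# = 1 }

    semiringView : AlmostCommutativeRing c ℓ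
    semiringView = fromCommutativeSemiring commutativeSemiring

    ⟦⟧-morphism : ℕ-rawRing -Raw-AlmostCommutative⟶ semiringView
    ⟦⟧-morphism = record
      { ⟦_⟧ = ⟦_⟧ ; +-homo = ⟦+⟧ ; *-homo = ⟦*⟧ ; -‿homo = λ _ → refl ; 0-homo = refl ; 1-homo = ⟦1⟧ }

    ⟦⟧-≟ : ∀ m n → Maybe (⟦ m ⟧ ≈ ⟦ n ⟧)
    ⟦⟧-≟ m n with m ℕ.≟ n
    ... | yes m≡n = just (⟦⟧-cong m≡n)
    ... | no  _   = nothing

  open import Algebra.Solver.Ring ℕ-rawRing semiringView ⟦⟧-morphism ⟦⟧-≟ public
    using (solve; _:=_; con; _:+_; _:*_)

  neg-square : ∀ x → (- x) * (- x) ≈ x * x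
  neg-square x = begin
    (- x) * (- x)  ≈⟨ -‿distribʳ-* (- x) x ⟨
    - ((- x) * x)  ≈⟨ -‿cong (-‿distribˡ-* x x) ⟨
    - (- (x * x))  ≈⟨ ⁻¹-involutive (x * x) ⟩
    x * x          ∎
    where
    open import Algebra.Properties.Ring ring using (-‿distribˡ-*; -‿distribʳ-*)
    open GroupProperties +-group using (⁻¹-involutive)

  neg-nonneg : ∀ {x} → x ≤ 0# → 0# ≤ - x
  neg-nonneg {x} x≤0 = ≤-respˡ-≈ (-‿inverseʳ x) (≤-respʳ-≈ (+-identityˡ (- x)) (+-mono-≤ (- x) x≤0))

  square-nonneg : ∀ x → 0# ≤ x * x
  square-nonneg x with total 0# x
  ... | inj₁ 0≤x = *-nonneg 0≤x 0≤x
  ... | inj₂ x≤0 = ≤-respʳ-≈ (neg-square x) (*-nonneg (neg-nonneg x≤0) (neg-nonneg x≤0))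

  0≤1 : 0# ≤ 1#
  0≤1 = ≤-respʳ-≈ (*-identityˡ 1#) (square-nonneg 1#)

  +-nonneg : ∀ {x y} → 0# ≤ x → 0# ≤ y → 0# ≤ x + y
  +-nonneg {x} {y} 0≤x 0≤y = ≤-trans 0≤y (≤-respˡ-≈ (+-identityˡ y) (+-mono-≤ y 0≤x))

  ⟦⟧-nonneg : ∀ m → 0# ≤ ⟦ m ⟧
  ⟦⟧-nonneg zero    = ≤-reflexive refl
  ⟦⟧-nonneg (suc m) = +-nonneg 0≤1 (⟦⟧-nonneg m)

  1≤⇒≉0 : ∀ {x} → 1# ≤ x → x ≉ 0#
  1≤⇒≉0 1≤x x≈0 = 0≉1 (antisym 0≤1 (≤-respʳ-≈ x≈0 1≤x))

  1≤1+ : ∀ {x} → 0# ≤ x → 1# ≤ 1# + x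
  1≤1+ {x} 0≤x = ≤-respʳ-≈ (+-comm x 1#) (≤-respˡ-≈ (+-identityˡ 1#) (+-mono-≤ 1# 0≤x))

  ⟦suc⟧≉0 : ∀ m → ⟦ suc m ⟧ ≉ 0#
  ⟦suc⟧≉0 m = 1≤⇒≉0 (1≤1+ (⟦⟧-nonneg m))

  ⟦⟧≉0 : ∀ {m} → 1 ℕ.≤ m → ⟦ m ⟧ ≉ 0#
  ⟦⟧≉0 {suc m} _ = ⟦suc⟧≉0 m

  *-cancelˡ : ∀ {s a b} → s ≉ 0# → s * a ≈ s * b → a ≈ b
  *-cancelˡ {s} {a} {b} s≉0 sa≈sb = begin
    a                   ≈⟨ *-identityˡ a ⟨
    1# * a              ≈⟨ *-congʳ (trans (*-comm _ _) (inverseʳ s s≉0)) ⟨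
    (s ⁻¹ * s) * a      ≈⟨ *-assoc _ _ _ ⟩
    s ⁻¹ * (s * a)      ≈⟨ *-congˡ sa≈sb ⟩
    s ⁻¹ * (s * b)      ≈⟨ *-assoc _ _ _ ⟨
    (s ⁻¹ * s) * b      ≈⟨ *-congʳ (trans (*-comm _ _) (inverseʳ s s≉0)) ⟩
    1# * b              ≈⟨ *-identityˡ b ⟩
    b                   ∎

  *-≉0 : ∀ {x y} → x ≉ 0# → y ≉ 0# → x * y ≉ 0#
  *-≉0 {x} {y} x≉0 y≉0 xy≈0 = y≉0 (*-cancelˡ x≉0 (trans xy≈0 (sym (zeroʳ x))))

  ⁻¹-nonneg : ∀ {x u} → 0# ≤ x → x * u ≈ 1# → 0# ≤ u
  ⁻¹-nonneg {x} {u} 0≤x xu≈1 = ≤-respʳ-≈ x[uu]≈u (*-nonneg 0≤x (square-nonneg u))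
    where
    x[uu]≈u : x * (u * u) ≈ u
    x[uu]≈u = trans (sym (*-assoc x u u)) (trans (*-congʳ xu≈1) (*-identityˡ u))

  ÷-unique : ∀ {x y z} → z ≉ 0# → y * z ≈ x → x ÷ z ≈ y
  ÷-unique {x} {y} {z} z≉0 yz≈x = begin
    x * z ⁻¹        ≈⟨ *-congʳ yz≈x ⟨
    y * z * z ⁻¹    ≈⟨ *-assoc y z (z ⁻¹) ⟩
    y * (z * z ⁻¹)  ≈⟨ *-congˡ (inverseʳ z z≉0) ⟩
    y * 1#          ≈⟨ *-identityʳ y ⟩
    y               ∎

  *-÷-cancel : ∀ {x y z} → z ≉ 0# → z * (x ÷ z * y) ≈ x * y
  *-÷-cancel {x} {y} {z} z≉0 = begin
    z * (x * z ⁻¹ * y)    ≈⟨ solve 4 (λ z x zi y → z :* (x :* zi :* y) := (z :* zi) :* (x :* y)) refl z x (z ⁻¹) y ⟩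
    (z * z ⁻¹) * (x * y)  ≈⟨ *-congʳ (inverseʳ z z≉0) ⟩
    1# * (x * y)          ≈⟨ *-identityˡ _ ⟩
    x * y                 ∎

  -- √x + y ≉ 0 can be cancelled from √x (√x + y) ≈ y (√x + y).
  √-unique : ∀ {x y} → 0# ≤ y → y * y ≈ x → x ≉ 0# → √ x ≈ y
  √-unique {x} {y} 0≤y yy≈x x≉0 = *-cancelˡ a+y≉0 (trans (*-comm _ _) (trans root-equation (*-comm _ _)))
    where
    0≤x : 0# ≤ x
    0≤x = ≤-respʳ-≈ yy≈x (square-nonneg y)
    a : Carrier
    a = √ x
    y≉0 : y ≉ 0#
    y≉0 y≈0 = x≉0 (trans (sym yy≈x) (trans (*-congʳ y≈0) (zeroˡ y)))
    a+y≉0 : a + y ≉ 0#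
    a+y≉0 a+y≈0 =
      y≉0 (antisym (≤-respʳ-≈ a+y≈0 (≤-respˡ-≈ (+-identityˡ y) (+-mono-≤ y (√-nonneg x 0≤x)))) 0≤y)
    root-equation : a * (a + y) ≈ y * (a + y)
    root-equation = begin
      a * (a + y)    ≈⟨ distribˡ a a y ⟩
      a * a + a * y  ≈⟨ +-cong (trans (√-square x 0≤x) (sym yy≈x)) (*-comm a y) ⟩
      y * y + y * a  ≈⟨ +-comm _ _ ⟩
      y * a + y * y  ≈⟨ distribˡ y a y ⟨
      y * (a + y)    ∎

  √-factor : ∀ {x y z} → 0# ≤ y → 0# ≤ z → y ≉ 0# → z ≉ 0# → y * y * z ≈ x → √ x ≈ y * √ z
  √-factor {x} {y} {z} 0≤y 0≤z y≉0 z≉0 yyz≈x =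
    √-unique (*-nonneg 0≤y (√-nonneg z 0≤z)) (begin
      (y * √ z) * (y * √ z)  ≈⟨ solve 2 (λ y r → (y :* r) :* (y :* r) := y :* y :* (r :* r)) refl y (√ z) ⟩
      y * y * (√ z * √ z)    ≈⟨ *-congˡ (√-square z 0≤z) ⟩
      y * y * z              ≈⟨ yyz≈x ⟩
      x                      ∎)
    (λ x≈0 → *-≉0 (*-≉0 y≉0 y≉0) z≉0 (trans yyz≈x x≈0))

  −-unique : ∀ {x y z} → y + z ≈ x → x − z ≈ y
  −-unique {x} {y} {z} y+z≈x = sym (x≈z//y y z x y+z≈x)

  square-− : ∀ {x y z} → x + y ≈ z → (x − z) * (x − z) ≈ y * y
  square-− {x} {y} {z} x+y≈z = trans (*-cong x−z≈-y x−z≈-y) (neg-square y)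
    where
    open GroupProperties +-group using (inverseˡ-unique)
    x−z≈-y : x − z ≈ - y
    x−z≈-y = inverseˡ-unique (x − z) y (begin
      x + - z + y    ≈⟨ solve 3 (λ x nz y → x :+ nz :+ y := (x :+ y) :+ nz) refl x (- z) y ⟩
      (x + y) + - z  ≈⟨ +-congʳ x+y≈z ⟩
      z + - z        ≈⟨ -‿inverseʳ z ⟩
      0#             ∎)

module FieldSums {c ℓ} (F : EuclideanField c ℓ) where
  open import Data.Nat using (zero; suc; _<_)
  import Data.Nat.Properties as ℕₚ
  open import Data.List using (List; []; _∷_; _++_; map; concatMap; upTo; foldr; length)
  open import Data.List.Properties using (upTo-∷ʳ)
  import Relation.Binary.PropositionalEquality as ≡
  open import Data.Nat.Tactic.RingSolver using (solve-∀)
  open FieldFacts F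
  open Counting using (sumBelow; sumBelow-suc)

  listSum : ∀ {A : Set} → List A → (A → Carrier) → Carrier
  listSum xs g = foldr (λ x acc → g x + acc) 0# xs

  listSum-++ : ∀ {A : Set} (xs ys : List A) g → listSum (xs ++ ys) g ≈ listSum xs g + listSum ys g
  listSum-++ []       ys g = sym (+-identityˡ _)
  listSum-++ (x ∷ xs) ys g = trans (+-congˡ (listSum-++ xs ys g)) (sym (+-assoc _ _ _))

  listSum-concatMap : ∀ {A B : Set} (h : A → List B) xs g →
                      listSum (concatMap h xs) g ≈ listSum xs (λ x → listSum (h x) g)
  listSum-concatMap h []       g = refl
  listSum-concatMap h (x ∷ xs) g = trans (listSum-++ (h x) (concatMap h xs) g) (+-congˡ (listSum-concatMap h xs g))

  listSum-map : ∀ {A B : Set} (h : A → B) xs g → listSum (map h xs) g ≈ listSum xs (λ x → g (h x))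
  listSum-map h []       g = refl
  listSum-map h (x ∷ xs) g = +-congˡ (listSum-map h xs g)

  listSum-ones : ∀ {A : Set} (xs : List A) → listSum xs (λ _ → 1#) ≈ ⟦ length xs ⟧
  listSum-ones []       = refl
  listSum-ones (x ∷ xs) = +-congˡ (listSum-ones xs)

  rangeSum : ℕ → (ℕ → Carrier) → Carrier
  rangeSum N g = listSum (upTo N) g

  rangeSum-suc : ∀ N g → rangeSum (suc N) g ≈ rangeSum N g + g N
  rangeSum-suc N g = begin
    listSum (upTo (suc N)) g        ≡⟨ ≡.cong (λ l → listSum l g) (≡.sym (upTo-∷ʳ N)) ⟩
    listSum (upTo N ++ N ∷ []) g    ≈⟨ listSum-++ (upTo N) (N ∷ []) g ⟩
    rangeSum N g + (g N + 0#)       ≈⟨ +-congˡ (+-identityʳ _) ⟩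
    rangeSum N g + g N              ∎

  rangeSum-cong : ∀ N {g h} → (∀ i → i < N → g i ≈ h i) → rangeSum N g ≈ rangeSum N h
  rangeSum-cong zero    g≈h = refl
  rangeSum-cong (suc N) {g} {h} g≈h = begin
    rangeSum (suc N) g  ≈⟨ rangeSum-suc N g ⟩
    rangeSum N g + g N  ≈⟨ +-cong (rangeSum-cong N (λ i i<N → g≈h i (ℕₚ.m<n⇒m<1+n i<N))) (g≈h N ℕₚ.≤-refl) ⟩
    rangeSum N h + h N  ≈⟨ rangeSum-suc N h ⟨
    rangeSum (suc N) h  ∎

  rangeSum-⟦⟧ : ∀ N (a : ℕ → ℕ) x → rangeSum N (λ i → ⟦ a i ⟧ * x) ≈ ⟦ sumBelow N a ⟧ * x
  rangeSum-⟦⟧ zero    a x = sym (zeroˡ x)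
  rangeSum-⟦⟧ (suc N) a x = begin
    rangeSum (suc N) (λ i → ⟦ a i ⟧ * x)     ≈⟨ rangeSum-suc N _ ⟩
    rangeSum N (λ i → ⟦ a i ⟧ * x) + ⟦ a N ⟧ * x ≈⟨ +-congʳ (rangeSum-⟦⟧ N a x) ⟩
    ⟦ sumBelow N a ⟧ * x + ⟦ a N ⟧ * x       ≈⟨ distribʳ x _ _ ⟨
    (⟦ sumBelow N a ⟧ + ⟦ a N ⟧) * x         ≈⟨ *-congʳ (⟦+⟧ (sumBelow N a) (a N)) ⟨
    ⟦ sumBelow N a ℕ.+ a N ⟧ * x             ≈⟨ *-congʳ (⟦⟧-cong (sumBelow-suc N a)) ⟨
    ⟦ sumBelow (suc N) a ⟧ * x               ∎

  rangeSum-const : ∀ N x → rangeSum N (λ _ → x) ≈ ⟦ N ⟧ * x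
  rangeSum-const zero    x = sym (zeroˡ x)
  rangeSum-const (suc N) x = begin
    rangeSum (suc N) (λ _ → x)  ≈⟨ rangeSum-suc N _ ⟩
    rangeSum N (λ _ → x) + x    ≈⟨ +-congʳ (rangeSum-const N x) ⟩
    ⟦ N ⟧ * x + x               ≈⟨ ⟦suc⟧-* N x ⟨
    ⟦ suc N ⟧ * x               ∎

  rangeSum-+ : ∀ a b g → rangeSum (a ℕ.+ b) g ≈ rangeSum a g + rangeSum b (λ i → g (a ℕ.+ i))
  rangeSum-+ a zero g rewrite ℕₚ.+-identityʳ a = sym (+-identityʳ _)
  rangeSum-+ a (suc b) g rewrite ℕₚ.+-suc a b = begin
    rangeSum (suc (a ℕ.+ b)) g                                     ≈⟨ rangeSum-suc (a ℕ.+ b) g ⟩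
    rangeSum (a ℕ.+ b) g + g (a ℕ.+ b)                             ≈⟨ +-congʳ (rangeSum-+ a b g) ⟩
    (rangeSum a g + rangeSum b (λ i → g (a ℕ.+ i))) + g (a ℕ.+ b)  ≈⟨ +-assoc _ _ _ ⟩
    rangeSum a g + (rangeSum b (λ i → g (a ℕ.+ i)) + g (a ℕ.+ b))  ≈⟨ +-congˡ (rangeSum-suc b _) ⟨
    rangeSum a g + rangeSum (suc b) (λ i → g (a ℕ.+ i))            ∎

  rangeSum-pairs : ∀ J g → rangeSum (2 ℕ.* J) g ≈ rangeSum J (λ j → g (2 ℕ.* j) + g (2 ℕ.* j ℕ.+ 1))
  rangeSum-pairs zero    g = refl
  rangeSum-pairs (suc J) g = begin
    rangeSum (2 ℕ.* suc J) g                               ≡⟨ ≡.cong (λ m → rangeSum m g) (2[1+J]≡2+2J J) ⟩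
    rangeSum (suc (suc (2 ℕ.* J))) g                       ≈⟨ rangeSum-suc _ g ⟩
    rangeSum (suc (2 ℕ.* J)) g + g (suc (2 ℕ.* J))         ≈⟨ +-congʳ (rangeSum-suc _ g) ⟩
    (rangeSum (2 ℕ.* J) g + g (2 ℕ.* J)) + g (suc (2 ℕ.* J))
      ≈⟨ +-assoc _ _ _ ⟩
    rangeSum (2 ℕ.* J) g + (g (2 ℕ.* J) + g (suc (2 ℕ.* J)))
      ≈⟨ +-cong (rangeSum-pairs J g) (+-congˡ (reflexive (≡.cong g (ℕₚ.+-comm 1 (2 ℕ.* J))))) ⟩
    rangeSum J (λ j → g (2 ℕ.* j) + g (2 ℕ.* j ℕ.+ 1)) + (g (2 ℕ.* J) + g (2 ℕ.* J ℕ.+ 1))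
      ≈⟨ rangeSum-suc J _ ⟨
    rangeSum (suc J) (λ j → g (2 ℕ.* j) + g (2 ℕ.* j ℕ.+ 1)) ∎
    where
    2[1+J]≡2+2J : ∀ J → 2 ℕ.* suc J ≡.≡ suc (suc (2 ℕ.* J))
    2[1+J]≡2+2J = solve-∀

module DegreeBasedIndex {c ℓ} (F : EuclideanField c ℓ) (k n : ℕ) (k≥1 : 1 ℕ.≤ k) where
  open import Data.Nat using (zero; suc; _∸_; _<_; z≤n; s≤s)
  import Data.Nat.Properties as ℕₚ
  open import Data.List using ([]; _∷_; map; concatMap; upTo)
  import Relation.Binary.PropositionalEquality as ≡
  open import Data.Nat.Tactic.RingSolver using (solve-∀)
  open FieldFacts F
  open FieldSums F
  open Indices F using (edgeSum)
  open Counting using (sumBelow)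
  open NanoconeDegrees k n k≥1

  K N : Carrier
  K = ⟦ k ⟧
  N = ⟦ n ⟧

  module _ (Φ : ℕ → ℕ → Carrier) (f : ℕ × ℕ → Carrier)
           (f≈Φ∘deg : ∀ a b → f (a , b) ≈ Φ (deg a) (deg b)) where

    by-degrees : ∀ {a b x y} → deg a ≡.≡ x → deg b ≡.≡ y → f (a , b) ≈ Φ x y
    by-degrees {a} {b} deg-a deg-b = trans (f≈Φ∘deg a b) (reflexive (≡.cong₂ Φ deg-a deg-b))

    cycle-sum : ∀ i → edgeSum (cycleEdges k i) f ≈
                rangeSum (size i ∸ 1) (λ r → f (offset i ℕ.+ r , offset i ℕ.+ suc r))
                  + f (offset i ℕ.+ (size i ∸ 1) , offset i)
    cycle-sum i = begin
      edgeSum (cycleEdges k i) f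
        ≈⟨ listSum-++ (map step (upTo last)) ((o ℕ.+ last , o) ∷ []) f ⟩
      listSum (map step (upTo last)) f + (f (o ℕ.+ last , o) + 0#)
        ≈⟨ +-cong (listSum-map step (upTo last) f) (+-identityʳ _) ⟩
      rangeSum last (λ r → f (step r)) + f (o ℕ.+ last , o)
        ∎
      where
      o last : ℕ
      o = offset i
      last = size i ∸ 1
      step : ℕ → ℕ × ℕ
      step r = (o ℕ.+ r , o ℕ.+ suc r)

    inner-cycle : ∀ {i} → i < n → edgeSum (cycleEdges k i) f ≈ ⟦ size i ⟧ * Φ 3 3
    inner-cycle {i} i<n = begin
      edgeSum (cycleEdges k i) f
        ≈⟨ cycle-sum i ⟩
      rangeSum last (λ r → f (o ℕ.+ r , o ℕ.+ suc r)) + f (o ℕ.+ last , o)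
        ≈⟨ +-cong (rangeSum-cong last (λ r r<last → by-degrees (inner (ℕₚ.<-trans r<last last<size))
                                                              (inner (≡.subst (suc r <_) (suc-pred-size i) (s≤s r<last)))))
                  (by-degrees (inner last<size) (≡.trans (≡.cong deg (≡.sym (ℕₚ.+-identityʳ o))) (inner (size≥1 i)))) ⟩
      rangeSum last (λ _ → Φ 3 3) + Φ 3 3
        ≈⟨ rangeSum-suc last _ ⟨
      rangeSum (suc last) (λ _ → Φ 3 3)
        ≈⟨ rangeSum-const (suc last) _ ⟩
      ⟦ suc last ⟧ * Φ 3 3
        ≈⟨ *-congʳ (⟦⟧-cong (suc-pred-size i)) ⟩
      ⟦ size i ⟧ * Φ 3 3
        ∎
      where
      o last : ℕ
      o = offset i
      last = size i ∸ 1
      last<size : last < size i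
      last<size = ≡.subst (last <_) (suc-pred-size i) ℕₚ.≤-refl
      inner : ∀ {t} → t < size i → deg (o ℕ.+ t) ≡.≡ 3
      inner = degree-inner-ring i<n

    spokes : ∀ {m} → m < n → edgeSum (spokeEdges k m) f ≈ ⟦ k ℕ.* suc m ⟧ * Φ 3 3
    spokes {m} m<n = begin
      edgeSum (spokeEdges k m) f
        ≈⟨ listSum-concatMap (λ s → map (λ j → (in-end s j , out-end s j)) (upTo (suc m))) (upTo k) f ⟩
      rangeSum k (λ s → listSum (map (λ j → (in-end s j , out-end s j)) (upTo (suc m))) f)
        ≈⟨ rangeSum-cong k (λ s s<k → begin
             listSum (map (λ j → (in-end s j , out-end s j)) (upTo (suc m))) f
               ≈⟨ listSum-map (λ j → (in-end s j , out-end s j)) (upTo (suc m)) f ⟩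
             rangeSum (suc m) (λ j → f (in-end s j , out-end s j))
               ≈⟨ rangeSum-cong (suc m) (λ j j≤m →
                    by-degrees (spoke-inner-end m<n s<k j≤m) (spoke-outer-end m<n s<k j≤m)) ⟩
             rangeSum (suc m) (λ _ → Φ 3 3)
               ≈⟨ rangeSum-const (suc m) _ ⟩
             ⟦ suc m ⟧ * Φ 3 3 ∎) ⟩
      rangeSum k (λ _ → ⟦ suc m ⟧ * Φ 3 3)  ≈⟨ rangeSum-const k _ ⟩
      K * (⟦ suc m ⟧ * Φ 3 3)               ≈⟨ *-assoc _ _ _ ⟨
      K * ⟦ suc m ⟧ * Φ 3 3                 ≈⟨ *-congʳ (⟦*⟧ k (suc m)) ⟨
      ⟦ k ℕ.* suc m ⟧ * Φ 3 3               ∎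
      where
      in-end out-end : ℕ → ℕ → ℕ
      in-end  s j = offset m ℕ.+ s ℕ.* (2 ℕ.* m ℕ.+ 1) ℕ.+ 2 ℕ.* j
      out-end s j = offset (suc m) ℕ.+ s ℕ.* (2 ℕ.* m ℕ.+ 3) ℕ.+ (2 ℕ.* j ℕ.+ 1)

    -- Along a sector of C_n the degrees read 2,3,2,…,3,2, and its last edge leads into the
    -- next sector (for the last sector, back to the first one: the closing edge of C_n).
    sectorSum : Carrier
    sectorSum = N * (Φ 2 3 + Φ 3 2) + Φ 2 2

    private
      w o : ℕ
      w = 2 ℕ.* n ℕ.+ 1
      o = offset n

      outer-edge : ℕ → Carrier
      outer-edge r = f (o ℕ.+ r , o ℕ.+ suc r)

    sector-interior : ∀ {s} → s < k → rangeSum (2 ℕ.* n) (λ p → outer-edge (s ℕ.* w ℕ.+ p)) ≈ N * (Φ 2 3 + Φ 3 2)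
    sector-interior {s} s<k = begin
      rangeSum (2 ℕ.* n) (λ p → outer-edge (s ℕ.* w ℕ.+ p))
        ≈⟨ rangeSum-pairs n _ ⟩
      rangeSum n (λ j → outer-edge (s ℕ.* w ℕ.+ 2 ℕ.* j) + outer-edge (s ℕ.* w ℕ.+ (2 ℕ.* j ℕ.+ 1)))
        ≈⟨ rangeSum-cong n (λ j j<n → +-cong
             (by-degrees (degree-even-outer s<k (ℕₚ.m<n⇒m<1+n j<n))
                         (≡.trans (≡.cong (λ p → deg (o ℕ.+ p)) (1+even (s ℕ.* w) j)) (degree-odd ℕₚ.≤-refl s<k j<n)))
             (by-degrees (degree-odd ℕₚ.≤-refl s<k j<n)
                         (≡.trans (≡.cong (λ p → deg (o ℕ.+ p)) (1+odd (s ℕ.* w) j)) (degree-even-outer s<k (s≤s j<n))))) ⟩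
      rangeSum n (λ _ → Φ 2 3 + Φ 3 2)
        ≈⟨ rangeSum-const n _ ⟩
      N * (Φ 2 3 + Φ 3 2)
        ∎
      where
      1+even : ∀ a j → suc (a ℕ.+ 2 ℕ.* j) ≡.≡ a ℕ.+ (2 ℕ.* j ℕ.+ 1)
      1+even = solve-∀
      1+odd : ∀ a j → suc (a ℕ.+ (2 ℕ.* j ℕ.+ 1)) ≡.≡ a ℕ.+ 2 ℕ.* suc j
      1+odd = solve-∀

    sector-exit : ∀ {s} → suc s < k → outer-edge (s ℕ.* w ℕ.+ 2 ℕ.* n) ≈ Φ 2 2
    sector-exit {s} 1+s<k = by-degrees (degree-even-outer (ℕₚ.<-trans ℕₚ.≤-refl 1+s<k) ℕₚ.≤-refl)
      (≡.trans (≡.cong (λ p → deg (o ℕ.+ p)) (exit s n)) (degree-even-outer {j = 0} 1+s<k (s≤s z≤n)))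
      where
      exit : ∀ s n → suc (s ℕ.* (2 ℕ.* n ℕ.+ 1) ℕ.+ 2 ℕ.* n) ≡.≡ suc s ℕ.* (2 ℕ.* n ℕ.+ 1) ℕ.+ 2 ℕ.* 0
      exit = solve-∀

    sectors : ∀ s → s < k → rangeSum (s ℕ.* w) outer-edge ≈ ⟦ s ⟧ * sectorSum
    sectors zero    _     = sym (zeroˡ sectorSum)
    sectors (suc s) 1+s<k = begin
      rangeSum (suc s ℕ.* w) outer-edge
        ≡⟨ ≡.cong (λ m → rangeSum m outer-edge) (ℕₚ.+-comm w (s ℕ.* w)) ⟩
      rangeSum (s ℕ.* w ℕ.+ w) outer-edge
        ≈⟨ rangeSum-+ (s ℕ.* w) w outer-edge ⟩
      rangeSum (s ℕ.* w) outer-edge + rangeSum w (λ p → outer-edge (s ℕ.* w ℕ.+ p))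
        ≡⟨ ≡.cong (λ m → rangeSum (s ℕ.* w) outer-edge + rangeSum m (λ p → outer-edge (s ℕ.* w ℕ.+ p)))
                  (ℕₚ.+-comm (2 ℕ.* n) 1) ⟩
      rangeSum (s ℕ.* w) outer-edge + rangeSum (suc (2 ℕ.* n)) (λ p → outer-edge (s ℕ.* w ℕ.+ p))
        ≈⟨ +-cong (sectors s s<k) (rangeSum-suc (2 ℕ.* n) _) ⟩
      ⟦ s ⟧ * sectorSum
        + (rangeSum (2 ℕ.* n) (λ p → outer-edge (s ℕ.* w ℕ.+ p)) + outer-edge (s ℕ.* w ℕ.+ 2 ℕ.* n))
        ≈⟨ +-congˡ (+-cong (sector-interior s<k) (sector-exit 1+s<k)) ⟩
      ⟦ s ⟧ * sectorSum + sectorSum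
        ≈⟨ ⟦suc⟧-* s sectorSum ⟨
      ⟦ suc s ⟧ * sectorSum
        ∎
      where
      s<k : s < k
      s<k = ℕₚ.<-trans ℕₚ.≤-refl 1+s<k

    outer-cycle : edgeSum (cycleEdges k n) f ≈ K * sectorSum
    outer-cycle = begin
      edgeSum (cycleEdges k n) f
        ≈⟨ cycle-sum n ⟩
      rangeSum (size n ∸ 1) outer-edge + f (o ℕ.+ (size n ∸ 1) , o)
        ≡⟨ ≡.cong (λ m → rangeSum m outer-edge + f (o ℕ.+ m , o)) last≡ ⟩
      rangeSum (k′ ℕ.* w ℕ.+ 2 ℕ.* n) outer-edge + f (o ℕ.+ (k′ ℕ.* w ℕ.+ 2 ℕ.* n) , o)
        ≈⟨ +-cong (rangeSum-+ (k′ ℕ.* w) (2 ℕ.* n) outer-edge) closing-edge ⟩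
      (rangeSum (k′ ℕ.* w) outer-edge + rangeSum (2 ℕ.* n) (λ p → outer-edge (k′ ℕ.* w ℕ.+ p))) + Φ 2 2
        ≈⟨ +-congʳ (+-cong (sectors k′ k′<k) (sector-interior k′<k)) ⟩
      (⟦ k′ ⟧ * sectorSum + N * (Φ 2 3 + Φ 3 2)) + Φ 2 2
        ≈⟨ +-assoc _ _ _ ⟩
      ⟦ k′ ⟧ * sectorSum + sectorSum
        ≈⟨ ⟦suc⟧-* k′ sectorSum ⟨
      ⟦ suc k′ ⟧ * sectorSum
        ≈⟨ *-congʳ (⟦⟧-cong 1+k′≡k) ⟩
      K * sectorSum
        ∎
      where
      k′ : ℕ
      k′ = k ∸ 1
      1+k′≡k : suc k′ ≡.≡ k
      1+k′≡k = ≡.trans (ℕₚ.+-comm 1 k′) (ℕₚ.m∸n+n≡m k≥1)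
      k′<k : k′ < k
      k′<k = ≡.subst (k′ <_) 1+k′≡k ℕₚ.≤-refl
      last≡ : size n ∸ 1 ≡.≡ k′ ℕ.* w ℕ.+ 2 ℕ.* n
      last≡ = ℕₚ.suc-injective (≡.trans (suc-pred-size n)
                (≡.trans (≡.cong (ℕ._* w) (≡.sym 1+k′≡k)) (unfold k′ n)))
        where
        unfold : ∀ k′ n → suc k′ ℕ.* (2 ℕ.* n ℕ.+ 1) ≡.≡ suc (k′ ℕ.* (2 ℕ.* n ℕ.+ 1) ℕ.+ 2 ℕ.* n)
        unfold = solve-∀
      closing-edge : f (o ℕ.+ (k′ ℕ.* w ℕ.+ 2 ℕ.* n) , o) ≈ Φ 2 2
      closing-edge = by-degrees (degree-even-outer k′<k ℕₚ.≤-refl)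
        (≡.trans (≡.cong deg (≡.sym (ℕₚ.+-identityʳ o))) (degree-even-outer {j = 0} k≥1 (s≤s z≤n)))

    edgeSum-by-degrees : edgeSum (edges (CNC k n)) f ≈
      (⟦ sumBelow n size ⟧ * Φ 3 3 + K * sectorSum) + ⟦ sumBelow n (λ m → k ℕ.* suc m) ⟧ * Φ 3 3
    edgeSum-by-degrees = begin
      edgeSum (edges (CNC k n)) f
        ≈⟨ listSum-++ (concatMap (cycleEdges k) (upTo (suc n))) (concatMap (spokeEdges k) (upTo n)) f ⟩
      edgeSum (concatMap (cycleEdges k) (upTo (suc n))) f + edgeSum (concatMap (spokeEdges k) (upTo n)) f
        ≈⟨ +-cong (listSum-concatMap (cycleEdges k) (upTo (suc n)) f) (listSum-concatMap (spokeEdges k) (upTo n) f) ⟩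
      rangeSum (suc n) (λ i → edgeSum (cycleEdges k i) f) + rangeSum n (λ m → edgeSum (spokeEdges k m) f)
        ≈⟨ +-cong (rangeSum-suc n _)
                  (trans (rangeSum-cong n (λ m → spokes)) (rangeSum-⟦⟧ n (λ m → k ℕ.* suc m) _)) ⟩
      (rangeSum n (λ i → edgeSum (cycleEdges k i) f) + edgeSum (cycleEdges k n) f)
        + ⟦ sumBelow n (λ m → k ℕ.* suc m) ⟧ * Φ 3 3
        ≈⟨ +-congʳ (+-cong (trans (rangeSum-cong n (λ i → inner-cycle)) (rangeSum-⟦⟧ n size _)) outer-cycle) ⟩
      (⟦ sumBelow n size ⟧ * Φ 3 3 + K * sectorSum) + ⟦ sumBelow n (λ m → k ℕ.* suc m) ⟧ * Φ 3 3
        ∎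

    twice-edgeSum-by-degrees : ⟦ 2 ⟧ * edgeSum (edges (CNC k n)) f
                               ≈ K * (N * (⟦ 3 ⟧ * N + ⟦ 1 ⟧) * Φ 3 3 + ⟦ 2 ⟧ * sectorSum)
    twice-edgeSum-by-degrees = begin
      ⟦ 2 ⟧ * edgeSum (edges (CNC k n)) f
        ≈⟨ *-congˡ edgeSum-by-degrees ⟩
      ⟦ 2 ⟧ * ((⟦ A ⟧ * Φ 3 3 + K * sectorSum) + ⟦ B ⟧ * Φ 3 3)
        ≈⟨ solve 5 (λ a b x K S → con 2 :* ((a :* x :+ K :* S) :+ b :* x) := con 2 :* (a :+ b) :* x :+ K :* (con 2 :* S))
                   refl ⟦ A ⟧ ⟦ B ⟧ (Φ 3 3) K sectorSum ⟩
      ⟦ 2 ⟧ * (⟦ A ⟧ + ⟦ B ⟧) * Φ 3 3 + K * (⟦ 2 ⟧ * sectorSum)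
        ≈⟨ +-congʳ (*-congʳ inner-count) ⟩
      K * N * (⟦ 3 ⟧ * N + ⟦ 1 ⟧) * Φ 3 3 + K * (⟦ 2 ⟧ * sectorSum)
        ≈⟨ solve 4 (λ K N x S → K :* N :* (con 3 :* N :+ con 1) :* x :+ K :* (con 2 :* S)
                              := K :* (N :* (con 3 :* N :+ con 1) :* x :+ con 2 :* S)) refl K N (Φ 3 3) sectorSum ⟩
      K * (N * (⟦ 3 ⟧ * N + ⟦ 1 ⟧) * Φ 3 3 + ⟦ 2 ⟧ * sectorSum)
        ∎
      where
      A B : ℕ
      A = sumBelow n size
      B = sumBelow n (λ m → k ℕ.* suc m)
      inner-count : ⟦ 2 ⟧ * (⟦ A ⟧ + ⟦ B ⟧) ≈ K * N * (⟦ 3 ⟧ * N + ⟦ 1 ⟧)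
      inner-count = begin
        ⟦ 2 ⟧ * (⟦ A ⟧ + ⟦ B ⟧)          ≈⟨ trans (⟦*⟧ 2 (A ℕ.+ B)) (*-congˡ (⟦+⟧ A B)) ⟨
        ⟦ 2 ℕ.* (A ℕ.+ B) ⟧              ≈⟨ ⟦⟧-cong (twice-inner-edges n) ⟩
        ⟦ k ℕ.* n ℕ.* (3 ℕ.* n ℕ.+ 1) ⟧  ≈⟨ ⟦*⟧ (k ℕ.* n) _ ⟩
        ⟦ k ℕ.* n ⟧ * ⟦ 3 ℕ.* n ℕ.+ 1 ⟧  ≈⟨ *-cong (⟦*⟧ k n) (trans (⟦+⟧ (3 ℕ.* n) 1) (+-congʳ (⟦*⟧ 3 n))) ⟩
        K * N * (⟦ 3 ⟧ * N + ⟦ 1 ⟧)      ∎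

module SomborIndices {c ℓ} (F : EuclideanField c ℓ) (k n : ℕ) (k≥1 : 1 ℕ.≤ k) where
  open import Data.Nat using (suc)
  open FieldFacts F
  open FieldSums F using (listSum-ones)
  open Indices F
  open DegreeBasedIndex F k n k≥1

  G : Graph
  G = CNC k n

  halve : ∀ {x y} → ⟦ 2 ⟧ * x ≈ ⟦ 2 ⟧ * y → x ≈ y
  halve = *-cancelˡ (⟦suc⟧≉0 1)

  √-factorℕ : ∀ y z {x} → ⟦ suc y ⟧ * ⟦ suc y ⟧ * ⟦ suc z ⟧ ≈ x → √ x ≈ ⟦ suc y ⟧ * √ ⟦ suc z ⟧
  √-factorℕ y z = √-factor (⟦⟧-nonneg (suc y)) (⟦⟧-nonneg (suc z)) (⟦suc⟧≉0 y) (⟦suc⟧≉0 z)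

  SO-value : SO G ≈ ⟦ 2 ⟧ * √ ⟦ 13 ⟧ * K * N
                    + (√ ⟦ 2 ⟧ * K ÷ ⟦ 2 ⟧) * (⟦ 9 ⟧ * N * N + ⟦ 3 ⟧ * N + ⟦ 4 ⟧)
  SO-value = halve (begin
    ⟦ 2 ⟧ * SO G
      ≈⟨ twice-edgeSum-by-degrees Φ _ (λ _ _ → refl) ⟩
    K * (N * (⟦ 3 ⟧ * N + ⟦ 1 ⟧) * Φ 3 3 + ⟦ 2 ⟧ * (N * (Φ 2 3 + Φ 3 2) + Φ 2 2))
      ≈⟨ *-congˡ (+-cong (*-congˡ Φ33) (*-congˡ (+-cong (*-congˡ (+-cong Φ23 Φ32)) Φ22))) ⟩
    K * (N * (⟦ 3 ⟧ * N + ⟦ 1 ⟧) * (⟦ 3 ⟧ * r2) + ⟦ 2 ⟧ * (N * (⟦ 1 ⟧ * r13 + ⟦ 1 ⟧ * r13) + ⟦ 2 ⟧ * r2))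
      ≈⟨ solve 4 (λ K N r2 r13 → K :* (N :* (con 3 :* N :+ con 1) :* (con 3 :* r2)
                                      :+ con 2 :* (N :* (con 1 :* r13 :+ con 1 :* r13) :+ con 2 :* r2))
                              := con 2 :* (con 2 :* r13 :* K :* N) :+ r2 :* K :* (con 9 :* N :* N :+ con 3 :* N :+ con 4))
                 refl K N r2 r13 ⟩
    ⟦ 2 ⟧ * (⟦ 2 ⟧ * r13 * K * N) + r2 * K * (⟦ 9 ⟧ * N * N + ⟦ 3 ⟧ * N + ⟦ 4 ⟧)
      ≈⟨ +-congˡ (*-÷-cancel (⟦suc⟧≉0 1)) ⟨
    ⟦ 2 ⟧ * (⟦ 2 ⟧ * r13 * K * N) + ⟦ 2 ⟧ * ((r2 * K ÷ ⟦ 2 ⟧) * (⟦ 9 ⟧ * N * N + ⟦ 3 ⟧ * N + ⟦ 4 ⟧))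
      ≈⟨ distribˡ _ _ _ ⟨
    ⟦ 2 ⟧ * (⟦ 2 ⟧ * r13 * K * N + (r2 * K ÷ ⟦ 2 ⟧) * (⟦ 9 ⟧ * N * N + ⟦ 3 ⟧ * N + ⟦ 4 ⟧))
      ∎)
    where
    Φ : ℕ → ℕ → Carrier
    Φ x y = √ (sq ⟦ x ⟧ + sq ⟦ y ⟧)
    r2 r13 : Carrier
    r2 = √ ⟦ 2 ⟧
    r13 = √ ⟦ 13 ⟧
    Φ33 : Φ 3 3 ≈ ⟦ 3 ⟧ * r2
    Φ33 = √-factorℕ 2 1 (solve 0 (con 3 :* con 3 :* con 2 := con 3 :* con 3 :+ con 3 :* con 3) refl)
    Φ23 : Φ 2 3 ≈ ⟦ 1 ⟧ * r13
    Φ23 = √-factorℕ 0 12 (solve 0 (con 1 :* con 1 :* con 13 := con 2 :* con 2 :+ con 3 :* con 3) refl)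
    Φ32 : Φ 3 2 ≈ ⟦ 1 ⟧ * r13
    Φ32 = √-factorℕ 0 12 (solve 0 (con 1 :* con 1 :* con 13 := con 3 :* con 3 :+ con 2 :* con 2) refl)
    Φ22 : Φ 2 2 ≈ ⟦ 2 ⟧ * r2
    Φ22 = √-factorℕ 1 1 (solve 0 (con 2 :* con 2 :* con 2 := con 2 :* con 2 :+ con 2 :* con 2) refl)

  SOred-value : SOred G ≈ ⟦ 2 ⟧ * √ ⟦ 5 ⟧ * K * N + √ ⟦ 2 ⟧ * K * (⟦ 3 ⟧ * N * N + N + 1#)
  SOred-value = halve (begin
    ⟦ 2 ⟧ * SOred G
      ≈⟨ twice-edgeSum-by-degrees Φ _ (λ _ _ → refl) ⟩
    K * (N * (⟦ 3 ⟧ * N + ⟦ 1 ⟧) * Φ 3 3 + ⟦ 2 ⟧ * (N * (Φ 2 3 + Φ 3 2) + Φ 2 2))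
      ≈⟨ *-congˡ (+-cong (*-congˡ Φ33) (*-congˡ (+-cong (*-congˡ (+-cong Φ23 Φ32)) Φ22))) ⟩
    K * (N * (⟦ 3 ⟧ * N + ⟦ 1 ⟧) * (⟦ 2 ⟧ * r2) + ⟦ 2 ⟧ * (N * (⟦ 1 ⟧ * r5 + ⟦ 1 ⟧ * r5) + ⟦ 1 ⟧ * r2))
      ≈⟨ solve 4 (λ K N r2 r5 → K :* (N :* (con 3 :* N :+ con 1) :* (con 2 :* r2)
                                     :+ con 2 :* (N :* (con 1 :* r5 :+ con 1 :* r5) :+ con 1 :* r2))
                             := con 2 :* (con 2 :* r5 :* K :* N :+ r2 :* K :* (con 3 :* N :* N :+ N :+ con 1)))
                 refl K N r2 r5 ⟩
    ⟦ 2 ⟧ * (⟦ 2 ⟧ * r5 * K * N + r2 * K * (⟦ 3 ⟧ * N * N + N + ⟦ 1 ⟧))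
      ≈⟨ *-congˡ (+-congˡ (*-congˡ (+-congˡ ⟦1⟧))) ⟩
    ⟦ 2 ⟧ * (⟦ 2 ⟧ * r5 * K * N + r2 * K * (⟦ 3 ⟧ * N * N + N + 1#))
      ∎)
    where
    φ : ℕ → Carrier
    φ x = ⟦ x ⟧ − 1#
    Φ : ℕ → ℕ → Carrier
    Φ x y = √ (sq (φ x) + sq (φ y))
    r2 r5 : Carrier
    r2 = √ ⟦ 2 ⟧
    r5 = √ ⟦ 5 ⟧
    φ-suc : ∀ x y → sq (φ (suc x)) + sq (φ (suc y)) ≈ sq ⟦ x ⟧ + sq ⟦ y ⟧
    φ-suc x y = +-cong (*-cong (φ≈ x) (φ≈ x)) (*-cong (φ≈ y) (φ≈ y))
      where
      φ≈ : ∀ x → φ (suc x) ≈ ⟦ x ⟧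
      φ≈ x = −-unique (+-comm ⟦ x ⟧ 1#)
    Φ33 : Φ 3 3 ≈ ⟦ 2 ⟧ * r2
    Φ33 = √-factorℕ 1 1
      (trans (solve 0 (con 2 :* con 2 :* con 2 := con 2 :* con 2 :+ con 2 :* con 2) refl) (sym (φ-suc 2 2)))
    Φ23 : Φ 2 3 ≈ ⟦ 1 ⟧ * r5
    Φ23 = √-factorℕ 0 4
      (trans (solve 0 (con 1 :* con 1 :* con 5 := con 1 :* con 1 :+ con 2 :* con 2) refl) (sym (φ-suc 1 2)))
    Φ32 : Φ 3 2 ≈ ⟦ 1 ⟧ * r5
    Φ32 = √-factorℕ 0 4
      (trans (solve 0 (con 1 :* con 1 :* con 5 := con 2 :* con 2 :+ con 1 :* con 1) refl) (sym (φ-suc 2 1)))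
    Φ22 : Φ 2 2 ≈ ⟦ 1 ⟧ * r2
    Φ22 = √-factorℕ 0 1
      (trans (solve 0 (con 1 :* con 1 :* con 2 := con 1 :* con 1 :+ con 1 :* con 1) refl) (sym (φ-suc 1 1)))

  u : Carrier
  u = (N + 1#) ⁻¹

  N+1≉0 : N + 1# ≉ 0#
  N+1≉0 N+1≈0 = ⟦suc⟧≉0 n (trans (+-comm 1# N) N+1≈0)

  [N+1]u≈1 : (N + ⟦ 1 ⟧) * u ≈ 1#
  [N+1]u≈1 = trans (*-congʳ (+-congˡ ⟦1⟧)) (inverseʳ (N + 1#) N+1≉0)

  u≉0 : u ≉ 0#
  u≉0 u≈0 = 0≉1 (trans (sym (zeroʳ _)) (trans (*-congˡ (sym u≈0)) [N+1]u≈1))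

  0≤u : 0# ≤ u
  0≤u = ⁻¹-nonneg (+-nonneg (⟦⟧-nonneg n) 0≤1) (inverseʳ (N + 1#) N+1≉0)

  avgDeg-value : avgDeg G ≈ (⟦ 3 ⟧ * N + ⟦ 2 ⟧) * u
  avgDeg-value = ÷-unique V≉0 (begin
    (⟦ 3 ⟧ * N + ⟦ 2 ⟧) * u * ⟦ nV G ⟧
      ≈⟨ *-congˡ V≈ ⟩
    (⟦ 3 ⟧ * N + ⟦ 2 ⟧) * u * (K * (N + ⟦ 1 ⟧) * (N + ⟦ 1 ⟧))
      ≈⟨ solve 3 (λ K N u → (con 3 :* N :+ con 2) :* u :* (K :* (N :+ con 1) :* (N :+ con 1))
                          := K :* (N :+ con 1) :* (con 3 :* N :+ con 2) :* ((N :+ con 1) :* u)) refl K N u ⟩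
    K * (N + ⟦ 1 ⟧) * (⟦ 3 ⟧ * N + ⟦ 2 ⟧) * ((N + ⟦ 1 ⟧) * u)
      ≈⟨ *-congˡ [N+1]u≈1 ⟩
    K * (N + ⟦ 1 ⟧) * (⟦ 3 ⟧ * N + ⟦ 2 ⟧) * 1#
      ≈⟨ solve 3 (λ K N one → K :* (N :+ con 1) :* (con 3 :* N :+ con 2) :* one
                            := K :* (N :* (con 3 :* N :+ con 1) :* one :+ con 2 :* (N :* (one :+ one) :+ one))) refl K N 1# ⟩
    K * (N * (⟦ 3 ⟧ * N + ⟦ 1 ⟧) * 1# + ⟦ 2 ⟧ * (N * (1# + 1#) + 1#))
      ≈⟨ twice-edgeSum-by-degrees (λ _ _ → 1#) (λ _ → 1#) (λ _ _ → refl) ⟨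
    ⟦ 2 ⟧ * edgeSum (edges G) (λ _ → 1#)
      ≈⟨ trans (*-congˡ (listSum-ones (edges G))) (sym (⟦*⟧ 2 (nE G))) ⟩
    ⟦ 2 ℕ.* nE G ⟧
      ∎)
    where
    V≈ : ⟦ nV G ⟧ ≈ K * (N + ⟦ 1 ⟧) * (N + ⟦ 1 ⟧)
    V≈ = trans (⟦*⟧ (k ℕ.* (n ℕ.+ 1)) (n ℕ.+ 1))
               (*-cong (trans (⟦*⟧ k (n ℕ.+ 1)) (*-congˡ (⟦+⟧ n 1))) (⟦+⟧ n 1))
    V≉0 : ⟦ nV G ⟧ ≉ 0#
    V≉0 V≈0 = *-≉0 (*-≉0 (⟦⟧≉0 k≥1) N+⟦1⟧≉0) N+⟦1⟧≉0 (trans (sym V≈) V≈0)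
      where
      N+⟦1⟧≉0 : N + ⟦ 1 ⟧ ≉ 0#
      N+⟦1⟧≉0 e = N+1≉0 (trans (+-congˡ (sym ⟦1⟧)) e)

  SOavr-value : 1 ℕ.≤ n →
                SOavr G ≈ (K * N ÷ ⟦ 2 ⟧) * ((⟦ 4 ⟧ ÷ (N + 1#)) * √ (N * N + 1#) + ⟦ 3 ⟧ * √ ⟦ 2 ⟧)
  SOavr-value n≥1 = halve (begin
    ⟦ 2 ⟧ * SOavr G
      ≈⟨ twice-edgeSum-by-degrees Φ _ (λ _ _ → refl) ⟩
    K * (N * (⟦ 3 ⟧ * N + ⟦ 1 ⟧) * Φ 3 3 + ⟦ 2 ⟧ * (N * (Φ 2 3 + Φ 3 2) + Φ 2 2))
      ≈⟨ *-congˡ (+-cong (*-congˡ Φ33) (*-congˡ (+-cong (*-congˡ (+-cong Φ23 Φ32)) Φ22))) ⟩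
    K * (N * (⟦ 3 ⟧ * N + ⟦ 1 ⟧) * (u * r2) + ⟦ 2 ⟧ * (N * (u * s + u * s) + (N * u) * r2))
      ≈⟨ solve 5 (λ K N u r2 s → K :* (N :* (con 3 :* N :+ con 1) :* (u :* r2)
                                       :+ con 2 :* (N :* (u :* s :+ u :* s) :+ (N :* u) :* r2))
                              := K :* N :* ((con 4 :* u) :* s :+ con 3 :* r2 :* ((N :+ con 1) :* u))) refl K N u r2 s ⟩
    K * N * ((⟦ 4 ⟧ * u) * s + ⟦ 3 ⟧ * r2 * ((N + ⟦ 1 ⟧) * u))
      ≈⟨ *-congˡ (+-congˡ (trans (*-congˡ [N+1]u≈1) (*-identityʳ _))) ⟩
    K * N * ((⟦ 4 ⟧ * u) * s + ⟦ 3 ⟧ * r2)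
      ≈⟨ *-÷-cancel (⟦suc⟧≉0 1) ⟨
    ⟦ 2 ⟧ * ((K * N ÷ ⟦ 2 ⟧) * ((⟦ 4 ⟧ ÷ (N + 1#)) * s + ⟦ 3 ⟧ * r2))
      ∎)
    where
    A : Carrier
    A = avgDeg G
    φ : ℕ → Carrier
    φ x = ⟦ x ⟧ − A
    Φ : ℕ → ℕ → Carrier
    Φ x y = √ (sq (φ x) + sq (φ y))
    r2 s : Carrier
    r2 = √ ⟦ 2 ⟧
    s = √ (N * N + 1#)

    φ3≈u : φ 3 ≈ u
    φ3≈u = −-unique (begin
      u + A                                  ≈⟨ +-congˡ avgDeg-value ⟩
      u + (⟦ 3 ⟧ * N + ⟦ 2 ⟧) * u            ≈⟨ solve 2 (λ N u → u :+ (con 3 :* N :+ con 2) :* u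
                                                              := con 3 :* ((N :+ con 1) :* u)) refl N u ⟩
      ⟦ 3 ⟧ * ((N + ⟦ 1 ⟧) * u)              ≈⟨ trans (*-congˡ [N+1]u≈1) (*-identityʳ _) ⟩
      ⟦ 3 ⟧                                  ∎)

    sq-φ2 : sq (φ 2) ≈ (N * u) * (N * u)
    sq-φ2 = square-− (begin
      ⟦ 2 ⟧ + N * u                          ≈⟨ +-congʳ (trans (*-congˡ [N+1]u≈1) (*-identityʳ _)) ⟨
      ⟦ 2 ⟧ * ((N + ⟦ 1 ⟧) * u) + N * u      ≈⟨ solve 2 (λ N u → con 2 :* ((N :+ con 1) :* u) :+ N :* u
                                                              := (con 3 :* N :+ con 2) :* u) refl N u ⟩
      (⟦ 3 ⟧ * N + ⟦ 2 ⟧) * u                ≈⟨ avgDeg-value ⟨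
      A                                      ∎)

    sq-φ3 : sq (φ 3) ≈ u * u
    sq-φ3 = *-cong φ3≈u φ3≈u

    0≤NN+1 : 0# ≤ N * N + 1#
    0≤NN+1 = +-nonneg (square-nonneg N) 0≤1

    NN+1≉0 : N * N + 1# ≉ 0#
    NN+1≉0 = 1≤⇒≉0 (≤-respʳ-≈ (+-comm 1# (N * N)) (1≤1+ (square-nonneg N)))

    N≉0 : N ≉ 0#
    N≉0 = ⟦⟧≉0 n≥1

    u²[N²+1] : u * u * (N * N + 1#) ≈ (N * u) * (N * u) + u * u
    u²[N²+1] = trans (*-congˡ (+-congˡ (sym ⟦1⟧)))
      (solve 2 (λ N u → u :* u :* (N :* N :+ con 1) := (N :* u) :* (N :* u) :+ u :* u) refl N u)

    Φ33 : Φ 3 3 ≈ u * r2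
    Φ33 = √-factor 0≤u (⟦⟧-nonneg 2) u≉0 (⟦suc⟧≉0 1)
      (trans (solve 1 (λ u → u :* u :* con 2 := u :* u :+ u :* u) refl u) (sym (+-cong sq-φ3 sq-φ3)))
    Φ23 : Φ 2 3 ≈ u * s
    Φ23 = √-factor 0≤u 0≤NN+1 u≉0 NN+1≉0 (trans u²[N²+1] (sym (+-cong sq-φ2 sq-φ3)))
    Φ32 : Φ 3 2 ≈ u * s
    Φ32 = √-factor 0≤u 0≤NN+1 u≉0 NN+1≉0 (trans u²[N²+1] (trans (+-comm _ _) (sym (+-cong sq-φ3 sq-φ2))))
    Φ22 : Φ 2 2 ≈ (N * u) * r2
    Φ22 = √-factor (*-nonneg (⟦⟧-nonneg n) 0≤u) (⟦⟧-nonneg 2) (*-≉0 N≉0 u≉0) (⟦suc⟧≉0 1)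
      (trans (solve 1 (λ x → x :* x :* con 2 := x :* x :+ x :* x) refl (N * u)) (sym (+-cong sq-φ2 sq-φ2)))

open import Data.Nat using (_<_; _≤_; s≤s; z≤n)
open import Data.Nat.Properties using (≤-trans)

mainTheorem11 : ∀ {c ℓ} (F : EuclideanField c ℓ) (k n : ℕ) → 4 < k → 1 ≤ n →
    let open EuclideanField F
        open Indices F
        G = CNC k n
    in (SO G ≈ ⟦ 2 ⟧ * √ ⟦ 13 ⟧ * ⟦ k ⟧ * ⟦ n ⟧
               + (√ ⟦ 2 ⟧ * ⟦ k ⟧ ÷ ⟦ 2 ⟧) * (⟦ 9 ⟧ * ⟦ n ⟧ * ⟦ n ⟧ + ⟦ 3 ⟧ * ⟦ n ⟧ + ⟦ 4 ⟧))
     × (SOred G ≈ ⟦ 2 ⟧ * √ ⟦ 5 ⟧ * ⟦ k ⟧ * ⟦ n ⟧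
               + √ ⟦ 2 ⟧ * ⟦ k ⟧ * (⟦ 3 ⟧ * ⟦ n ⟧ * ⟦ n ⟧ + ⟦ n ⟧ + 1#))
     × (SOavr G ≈ (⟦ k ⟧ * ⟦ n ⟧ ÷ ⟦ 2 ⟧)
               * ((⟦ 4 ⟧ ÷ (⟦ n ⟧ + 1#)) * √ (⟦ n ⟧ * ⟦ n ⟧ + 1#) + ⟦ 3 ⟧ * √ ⟦ 2 ⟧))
mainTheorem11 F k n 4<k n≥1 = SO-value , SOred-value , SOavr-value n≥1
  where open SomborIndices F k n (≤-trans (s≤s z≤n) 4<k)
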